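{- Let $n\ge 2$. (1) The number of $2$-dissections of a convex regular $n$-gon modulo the cyclic action is \[ |G(n,2)/Z_n|=\begin{cases}\frac{1}{12}n(n-2)(n-4), & n \text{ even},\\[2pt] \frac{1}{12}(n+1)(n-3)(n-4), & n\text{ odd}.\end{cases} \] (2) The number of $2$-dissections of a convex regular $n$-gon modulo the dihedral action is \[ |G(n,2)/D_{2n}|=\begin{cases}\frac{1}{24}(n-4)(n-2)(n+3), & n \text{ even},\\[2pt] \frac{1}{24}(n-3)(n^2-13), & n\text{ odd}.\end{cases} \]
   Context: A $k$-dissection of a convex regular $n$-gon is a partition of it into $k+1$ polygons by $k$ pairwise non-crossing diagonals; $G(n,k)$ is the set of $k$-dissections (vertices labelled $0,\dots,n-1$ in cyclic order), and it is empty when no such dissection exists (e.g. $G(n,2)=\emptyset$ for $n<5$). The cyclic group $Z_n$ (rotations) and the dihedral group $D_{2n}$ (symmetries of the regular $n$-gon) act on $G(n,k)$, and $G(n,k)/Z_n$, $G(n,k)/D_{2n}$ denote the sets of orbits. -}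

module Defs where

open import Data.Nat using (ℕ; zero; suc; _+_; _*_; _∸_; _<_; _≤_; _%_)
open import Data.Bool using (Bool; true; false; if_then_else_)
open import Data.Product using (Σ; _×_; _,_; ∃; ∃-syntax)
open import Data.Sum using (_⊎_)
open import Data.List using (List; length)
open import Data.List.Relation.Unary.Any using (Any)
open import Data.List.Relation.Unary.AllPairs using (AllPairs)
open import Relation.Nullary using (¬_)
open import Relation.Binary.PropositionalEquality using (_≡_)

-- Vertices of the n-gon are the naturals 0,…,n-1 in cyclic order.
-- A diagonal is an unordered pair {a,b} of vertices, stored with a < b,
-- whose endpoints are not adjacent on the polygon.
record Diagonal (n : ℕ) : Set where
  constructor diag
  field
    a b     : ℕ
    a<b     : a < b
    b<n     : b < n
    nonadj  : 2 ≤ b ∸ a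
    notWrap : ¬ (a ≡ 0 × suc b ≡ n)        -- not the side {0, n-1}
open Diagonal public

Cross : ∀ {n} → Diagonal n → Diagonal n → Set
Cross d e = (a d < a e × a e < b d × b d < b e) ⊎ (a e < a d × a d < b e × b e < b d)

-- A 2-dissection: a set {d₁, d₂} of two distinct non-crossing diagonals.
-- (Stored as an ordered pair; equality as sets is built into the action below.)
record Dissection2 (n : ℕ) : Set where
  constructor diss
  field
    d₁ d₂    : Diagonal n
    distinct : ¬ (a d₁ ≡ a d₂ × b d₁ ≡ b d₂)
    noCross  : ¬ Cross d₁ d₂
open Dissection2 public

-- v mod n (n = 0 never occurs in use)
modN : ℕ → ℕ → ℕ
modN zero    v = v
modN (suc m) v = v % suc m

-- Elements of D_{2n}: (false , r) is rotation v ↦ v + r, (true , r) is the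
-- reflection v ↦ r - v (mod n), for r < n.  Z_n = the elements with flag false.
actV : (n : ℕ) → Bool → ℕ → ℕ → ℕ
actV n false r v = modN n (v + r)
actV n true  r v = modN n (r + (n ∸ v))

PairImg : (n : ℕ) → Bool → ℕ → ℕ → ℕ → ℕ → ℕ → Set
PairImg n f r x y u w =
  (actV n f r x ≡ u × actV n f r y ≡ w) ⊎ (actV n f r x ≡ w × actV n f r y ≡ u)

DiagImg : ∀ {n} → Bool → ℕ → Diagonal n → Diagonal n → Set
DiagImg {n} f r d e = PairImg n f r (a d) (b d) (a e) (b e)

DissImg : ∀ {n} → Bool → ℕ → Dissection2 n → Dissection2 n → Set
DissImg f r X Y =
  (DiagImg f r (d₁ X) (d₁ Y) × DiagImg f r (d₂ X) (d₂ Y))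
  ⊎ (DiagImg f r (d₁ X) (d₂ Y) × DiagImg f r (d₂ X) (d₁ Y))

SameOrbitZ : ∀ {n} → Dissection2 n → Dissection2 n → Set
SameOrbitZ {n} X Y = ∃[ r ] (r < n × DissImg false r X Y)

SameOrbitD : ∀ {n} → Dissection2 n → Dissection2 n → Set
SameOrbitD {n} X Y = ∃[ f ] ∃[ r ] (r < n × DissImg f r X Y)

-- The number of orbits of a relation R on A is m: there is a system of
-- orbit representatives of size m (pairwise inequivalent, meeting every orbit).
NumOrbits : {A : Set} → (A → A → Set) → ℕ → Set
NumOrbits {A} R m =
  Σ (List A) λ L → length L ≡ m × AllPairs (λ x y → ¬ R x y) L
                 × (∀ x → Any (λ y → R x y) L)

-- Walking once around the polygon from an endpoint of one diagonal, a
-- 2-dissection is described by its gap type (P, S, Q, T): the first diagonal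
-- spans P sides, S boundary sides lead to the second diagonal, which spans Q
-- sides, and T sides lead back.  A dissection realizes exactly the types u and
-- σ u (σ starts the walk at the other diagonal); dissections realizing the
-- same type are rotations of each other; and a reflection turns a realization
-- of u into one of ρ u (the reversed walk).  Hence Z_n-orbits correspond to the
-- σ-classes of admissible types and D_{2n}-orbits to the ⟨σ , ρ⟩-classes, and
-- the theorem reduces to counting canonical representatives of these classes.

module Submission where

open import Defs
open import Data.Nat using (ℕ; _+_; _*_; _∸_; _≤_; _%_)
open import Data.Product using (_×_; ∃-syntax)
open import Relation.Binary.PropositionalEquality using (_≡_)

open import Data.Nat
open import Data.Nat.Properties
open import Data.Nat.DivMod
open import Data.Nat.Tactic.RingSolver
open import Data.Bool using (true; false)
open import Data.Empty using (⊥; ⊥-elim)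
open import Data.Unit using (⊤; tt)
open import Data.Product using (Σ; _,_; proj₁; proj₂)
open import Data.Sum using (_⊎_; inj₁; inj₂; [_,_]′)
open import Data.List using (List; []; _∷_; _++_; map; length)
open import Data.List.Properties using (length-map; length-++)
open import Data.List.Relation.Unary.All as All using (All; []; _∷_)
import Data.List.Relation.Unary.All.Properties as AllProps
open import Data.List.Relation.Unary.AllPairs as AllPairs using (AllPairs; []; _∷_)
import Data.List.Relation.Unary.AllPairs.Properties as AllPairsProps
open import Data.List.Relation.Unary.Any using (Any; here; there)
open import Data.List.Membership.Propositional using (_∈_)
open import Data.List.Membership.Propositional.Properties using (∈-map⁺; ∈-++⁺ˡ; ∈-++⁺ʳ)
open import Relation.Nullary using (¬_; yes; no)
open import Relation.Nullary.Decidable using (from-no)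
open import Relation.Binary.Definitions using (Tri; tri<; tri≈; tri>)
open import Relation.Binary.PropositionalEquality
open ≡-Reasoning

record Gaps : Set where
  constructor gaps
  field P S Q T : ℕ
open Gaps

gaps-≡ : ∀ {u w} → P u ≡ P w → S u ≡ S w → Q u ≡ Q w → T u ≡ T w → u ≡ w
gaps-≡ {gaps _ _ _ _} {gaps _ _ _ _} refl refl refl refl = refl

-- σ exchanges the roles of the two diagonals; ρ reverses the direction of the
-- walk, which is what a reflection of the polygon does.  Both are defined by
-- projections, so that σ (σ u) and ρ (ρ u) are u definitionally.
σ : Gaps → Gaps
σ u = gaps (Q u) (T u) (P u) (S u)

ρ : Gaps → Gaps
ρ u = gaps (P u) (T u) (Q u) (S u)

σ-perimeter : ∀ p s q t → q + t + p + s ≡ p + s + q + t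
σ-perimeter = solve-∀

ρ-perimeter : ∀ p s q t → p + t + q + s ≡ p + s + q + t
ρ-perimeter = solve-∀

-- The gap types occurring in an n-gon: a diagonal spans at least two sides,
-- the two diagonals differ (S + T ≥ 1), and the walk has length n.
record Admissible (n : ℕ) (u : Gaps) : Set where
  constructor admissible
  field
    2≤P       : 2 ≤ P u
    2≤Q       : 2 ≤ Q u
    1≤S+T     : 1 ≤ S u + T u
    perimeter : P u + S u + Q u + T u ≡ n
open Admissible

part< : ∀ {k e n} → 1 ≤ e → k + e ≡ n → k < n
part< {k} 1≤e k+e≡n = subst (k <_) k+e≡n (m<m+n k 1≤e)

nonzero-sum : ∀ s t → (s ≡ 0 → t ≡ 0 → ⊥) → 1 ≤ s + t
nonzero-sum zero    zero    ¬both = ⊥-elim (¬both refl refl)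
nonzero-sum zero    (suc t) _     = s≤s z≤n
nonzero-sum (suc s) t       _     = s≤s z≤n

1≤2+ : ∀ {k} e → 2 ≤ k → 1 ≤ k + e
1≤2+ {k} e 2≤k = ≤-trans (s≤s z≤n) (≤-trans 2≤k (m≤m+n k e))

module _ {n u} (A : Admissible n u) where
  private
    p = P u
    s = S u
    q = Q u
    t = T u
    total = perimeter A

  P+Q<n : p + q < n
  P+Q<n = part< (1≤S+T A) (trans (regroup p s q t) total)
    where
    regroup : ∀ p s q t → p + q + (s + t) ≡ p + s + q + t
    regroup = solve-∀

  P+S<n : p + s < n
  P+S<n = part< (1≤2+ t (2≤Q A)) (trans (sym (+-assoc (p + s) q t)) total)

  S+Q<n : s + q < n
  S+Q<n = part< (1≤2+ t (2≤P A)) (trans (regroup p s q t) total)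
    where
    regroup : ∀ p s q t → s + q + (p + t) ≡ p + s + q + t
    regroup = solve-∀

  Q+T<n : q + t < n
  Q+T<n = part< (1≤2+ s (2≤P A)) (trans (regroup p s q t) total)
    where
    regroup : ∀ p s q t → q + t + (p + s) ≡ p + s + q + t
    regroup = solve-∀

  T+P<n : t + p < n
  T+P<n = part< (1≤2+ s (2≤Q A)) (trans (regroup p s q t) total)
    where
    regroup : ∀ p s q t → t + p + (q + s) ≡ p + s + q + t
    regroup = solve-∀

  S+Q+T<n : s + q + t < n
  S+Q+T<n = part< (1≤2+ 0 (2≤P A)) (trans (regroup p s q t) total)
    where
    regroup : ∀ p s q t → s + q + t + (p + 0) ≡ p + s + q + t
    regroup = solve-∀

  T+P+S<n : t + p + s < n
  T+P+S<n = part< (1≤2+ 0 (2≤Q A)) (trans (regroup p s q t) total)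
    where
    regroup : ∀ p s q t → t + p + s + (q + 0) ≡ p + s + q + t
    regroup = solve-∀

  size≥5 : 5 ≤ n
  size≥5 = ≤-trans (s≤s (+-mono-≤ (2≤P A) (2≤Q A))) P+Q<n

admissible-σ : ∀ {n u} → Admissible n u → Admissible n (σ u)
admissible-σ {u = gaps p s q t} (admissible 2≤p 2≤q 1≤s+t e) =
  admissible 2≤q 2≤p (subst (1 ≤_) (+-comm s t) 1≤s+t) (trans (σ-perimeter p s q t) e)

admissible-ρ : ∀ {n u} → Admissible n u → Admissible n (ρ u)
admissible-ρ {u = gaps p s q t} (admissible 2≤p 2≤q 1≤s+t e) =
  admissible 2≤p 2≤q (subst (1 ≤_) (+-comm s t) 1≤s+t) (trans (ρ-perimeter p s q t) e)

record Enumerates {A : Set} (R : A → Set) (xs : List A) : Set where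
  constructor enumerates
  field
    distinct : AllPairs _≢_ xs
    sound    : All R xs
    complete : ∀ x → R x → x ∈ xs
open Enumerates

module _ {A : Set} where

  enum-[] : {R : A → Set} → (∀ x → ¬ R x) → Enumerates R []
  enum-[] none = enumerates [] [] (λ x r → ⊥-elim (none x r))

  enum-∷ : {R R' : A → Set} {x : A} {xs : List A} → R x → ¬ R' x → Enumerates R' xs →
           (∀ y → R' y → R y) → (∀ y → R y → y ≡ x ⊎ R' y) → Enumerates R (x ∷ xs)
  enum-∷ {R' = R'} rx ¬r'x (enumerates dist snd cmp) R'⊆R split =
    enumerates (All.map (λ r'y x≡y → ¬r'x (subst R' (sym x≡y) r'y)) snd ∷ dist)
               (rx ∷ All.map (R'⊆R _) snd)
               (λ y ry → [ here , (λ r'y → there (cmp y r'y)) ]′ (split y ry))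

  enum-++ : {R R₁ R₂ : A → Set} {xs ys : List A} → Enumerates R₁ xs → Enumerates R₂ ys →
            (∀ x → R₁ x → ¬ R₂ x) → (∀ x → R₁ x → R x) → (∀ x → R₂ x → R x) →
            (∀ x → R x → R₁ x ⊎ R₂ x) → Enumerates R (xs ++ ys)
  enum-++ {R₂ = R₂} {xs} (enumerates dist₁ snd₁ cmp₁) (enumerates dist₂ snd₂ cmp₂) disj R₁⊆R R₂⊆R split =
    enumerates
      (AllPairsProps.++⁺ dist₁ dist₂
         (All.map (λ {x} r₁x → All.map (λ r₂y x≡y → disj x r₁x (subst R₂ (sym x≡y) r₂y)) snd₂) snd₁))
      (AllProps.++⁺ (All.map (R₁⊆R _) snd₁) (All.map (R₂⊆R _) snd₂))
      (λ x rx → [ (λ r₁x → ∈-++⁺ˡ (cmp₁ x r₁x)) , (λ r₂x → ∈-++⁺ʳ xs (cmp₂ x r₂x)) ]′ (split x rx))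

module _ {A B : Set} where

  enum-map : {R : A → Set} {R' : B → Set} {xs : List A} (f : A → B) →
             (∀ {x y} → f x ≡ f y → x ≡ y) → Enumerates R xs →
             (∀ x → R x → R' (f x)) → (∀ y → R' y → Σ A (λ x → R x × y ≡ f x)) →
             Enumerates R' (map f xs)
  enum-map f f-inj (enumerates dist snd cmp) maps-to onto =
    enumerates (AllPairsProps.map⁺ (AllPairs.map (λ x≢y fx≡fy → x≢y (f-inj fx≡fy)) dist))
               (AllProps.map⁺ (All.map (maps-to _) snd))
               (λ y r'y → let (x , rx , y≡fx) = onto y r'y in
                          subst (_∈ map f _) (sym y≡fx) (∈-map⁺ f (cmp x rx)))

enum-⇔ : {A : Set} {R R' : A → Set} {xs : List A} →
         (∀ x → R x → R' x) → (∀ x → R' x → R x) → Enumerates R xs → Enumerates R' xs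
enum-⇔ to from (enumerates dist snd cmp) =
  enumerates dist (All.map (to _) snd) (λ x r'x → cmp x (from x r'x))

SumsTo : ℕ → ℕ × ℕ → Set
SumsTo k (s , t) = s + t ≡ k

Balanced : ℕ × ℕ → Set
Balanced (s , t) = s ≤ t

incFst : ℕ × ℕ → ℕ × ℕ
incFst (s , t) = (suc s , t)

incBoth : ℕ × ℕ → ℕ × ℕ
incBoth (s , t) = (suc s , suc t)

splits : ℕ → List (ℕ × ℕ)
splits zero    = (0 , 0) ∷ []
splits (suc k) = (0 , suc k) ∷ map incFst (splits k)

enum-splits : ∀ k → Enumerates (SumsTo k) (splits k)
enum-splits zero = enum-∷ refl (λ ()) (enum-[] (λ _ ())) (λ _ ()) split
  where
  split : ∀ st → SumsTo 0 st → st ≡ (0 , 0) ⊎ ⊥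
  split (zero , zero) _ = inj₁ refl
enum-splits (suc k) =
  enum-∷ {R' = λ st → 1 ≤ proj₁ st × SumsTo (suc k) st} refl (λ ())
    (enum-map incFst (λ { {s , t} refl → refl }) (enum-splits k) maps-to onto)
    (λ _ → proj₂) split
  where
  maps-to : ∀ st → SumsTo k st → 1 ≤ proj₁ (incFst st) × SumsTo (suc k) (incFst st)
  maps-to (s , t) e = s≤s z≤n , cong suc e
  onto : ∀ st → 1 ≤ proj₁ st × SumsTo (suc k) st → Σ (ℕ × ℕ) (λ st' → SumsTo k st' × st ≡ incFst st')
  onto (suc s , t) (_ , e) = (s , t) , suc-injective e , refl
  split : ∀ st → SumsTo (suc k) st → st ≡ (0 , suc k) ⊎ (1 ≤ proj₁ st × SumsTo (suc k) st)
  split (zero , t)  e = inj₁ (cong (0 ,_) e)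
  split (suc s , t) e = inj₂ (s≤s z≤n , e)

length-splits : ∀ k → length (splits k) ≡ suc k
length-splits zero    = refl
length-splits (suc k) = cong suc (trans (length-map incFst (splits k)) (length-splits k))

balancedSplits : ℕ → List (ℕ × ℕ)
balancedSplits zero                = (0 , 0) ∷ []
balancedSplits (suc zero)          = (0 , 1) ∷ []
balancedSplits (suc (suc k))       = (0 , suc (suc k)) ∷ map incBoth (balancedSplits k)

BalancedSum : ℕ → ℕ × ℕ → Set
BalancedSum k st = SumsTo k st × Balanced st

enum-balancedSplits : ∀ k → Enumerates (BalancedSum k) (balancedSplits k)
enum-balancedSplits zero = enum-∷ (refl , z≤n) (λ ()) (enum-[] (λ _ ())) (λ _ ()) split
  where
  split : ∀ st → BalancedSum 0 st → st ≡ (0 , 0) ⊎ ⊥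
  split (zero , zero) _ = inj₁ refl
enum-balancedSplits (suc zero) = enum-∷ (refl , z≤n) (λ ()) (enum-[] (λ _ ())) (λ _ ()) split
  where
  split : ∀ st → BalancedSum 1 st → st ≡ (0 , 1) ⊎ ⊥
  split (zero , t)         (e , _)   = inj₁ (cong (0 ,_) e)
  split (suc zero , zero)  (_ , ())
  split (suc zero , suc t) (() , _)
  split (suc (suc s) , t)  (() , _)
enum-balancedSplits (suc (suc k)) =
  enum-∷ {R' = λ st → 1 ≤ proj₁ st × BalancedSum (suc (suc k)) st} (refl , z≤n) (λ ())
    (enum-map incBoth (λ { {s , t} refl → refl }) (enum-balancedSplits k) maps-to onto)
    (λ _ → proj₂) split
  where
  maps-to : ∀ st → BalancedSum k st → 1 ≤ proj₁ (incBoth st) × BalancedSum (suc (suc k)) (incBoth st)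
  maps-to (s , t) (e , s≤t) = s≤s z≤n , cong suc (trans (+-suc s t) (cong suc e)) , s≤s s≤t
  onto : ∀ st → 1 ≤ proj₁ st × BalancedSum (suc (suc k)) st →
         Σ (ℕ × ℕ) (λ st' → BalancedSum k st' × st ≡ incBoth st')
  onto (suc s , suc t) (_ , e , s≤s s≤t) =
    (s , t) , (suc-injective (trans (sym (+-suc s t)) (suc-injective e)) , s≤t) , refl
  split : ∀ st → BalancedSum (suc (suc k)) st →
          st ≡ (0 , suc (suc k)) ⊎ (1 ≤ proj₁ st × BalancedSum (suc (suc k)) st)
  split (zero , t)  (e , _) = inj₁ (cong (0 ,_) e)
  split (suc s , t) b       = inj₂ (s≤s z≤n , b)

length-balanced-even : ∀ j → length (balancedSplits (j + j)) ≡ suc j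
length-balanced-even zero = refl
length-balanced-even (suc j) rewrite +-suc j j =
  cong suc (trans (length-map incBoth (balancedSplits (j + j))) (length-balanced-even j))

length-balanced-odd : ∀ j → length (balancedSplits (suc (j + j))) ≡ suc j
length-balanced-odd zero = refl
length-balanced-odd (suc j) rewrite +-suc j j =
  cong suc (trans (length-map incBoth (balancedSplits (suc (j + j)))) (length-balanced-odd j))

incQ : Gaps → Gaps
incQ (gaps p s q t) = gaps p s (suc q) t

shift : Gaps → Gaps
shift (gaps p s q t) = gaps (suc p) s (suc q) t

incQ-injective : ∀ {u v} → incQ u ≡ incQ v → u ≡ v
incQ-injective {gaps _ _ _ _} {gaps _ _ _ _} refl = refl

shift-injective : ∀ {u v} → shift u ≡ shift v → u ≡ v
shift-injective {gaps _ _ _ _} {gaps _ _ _ _} refl = refl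

incQ-total : ∀ p s q t → p + s + suc q + t ≡ suc (p + s + q + t)
incQ-total = solve-∀

shift-total : ∀ p s q t → suc p + s + suc q + t ≡ 2 + (p + s + q + t)
shift-total = solve-∀

admissible-incQ : ∀ {n u} → Admissible n u → Admissible (suc n) (incQ u)
admissible-incQ {u = gaps p s q t} (admissible 2≤p 2≤q 1≤s+t e) =
  admissible 2≤p (m≤n⇒m≤1+n 2≤q) 1≤s+t (trans (incQ-total p s q t) (cong suc e))

admissible-decQ : ∀ {n p s q t} → 2 ≤ q → Admissible (suc n) (gaps p s (suc q) t) → Admissible n (gaps p s q t)
admissible-decQ {p = p} {s} {q} {t} 2≤q (admissible 2≤p _ 1≤s+t e) =
  admissible 2≤p 2≤q 1≤s+t (suc-injective (trans (sym (incQ-total p s q t)) e))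

admissible-shift : ∀ {n u} → Admissible n u → Admissible (2 + n) (shift u)
admissible-shift {u = gaps p s q t} (admissible 2≤p 2≤q 1≤s+t e) =
  admissible (m≤n⇒m≤1+n 2≤p) (m≤n⇒m≤1+n 2≤q) 1≤s+t (trans (shift-total p s q t) (cong (2 +_) e))

admissible-unshift : ∀ {n p s q t} → 2 ≤ p → 2 ≤ q → Admissible (2 + n) (gaps (suc p) s (suc q) t) →
                     Admissible n (gaps p s q t)
admissible-unshift {p = p} {s} {q} {t} 2≤p 2≤q (admissible _ _ 1≤s+t e) =
  admissible 2≤p 2≤q 1≤s+t (+-cancelˡ-≡ 2 _ _ (trans (sym (shift-total p s q t)) e))

-- The admissible types with P ≡ 2 whose gap pair (S , T) satisfies Ok, given
-- an enumeration `pairs k` of the pairs with sum k satisfying Ok.  Those with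
-- Q ≡ 2 come straight from `pairs`; those with Q ≥ 3 are the types of the
-- (n-1)-gon with Q incremented.
module TypesP2 (Ok : ℕ × ℕ → Set) (pairs : ℕ → List (ℕ × ℕ))
               (enum-pairs : ∀ k → Enumerates (λ st → SumsTo k st × Ok st) (pairs k)) where

  WithP2 : ℕ → Gaps → Set
  WithP2 n u = Admissible n u × P u ≡ 2 × Ok (S u , T u)

  WithP2Q2 : ℕ → Gaps → Set
  WithP2Q2 n u = WithP2 n u × Q u ≡ 2

  typeP2Q2 : ℕ × ℕ → Gaps
  typeP2Q2 (s , t) = gaps 2 s 2 t

  typesP2Q2 : ℕ → List Gaps
  typesP2Q2 (suc (suc (suc (suc (suc k))))) = map typeP2Q2 (pairs (suc k))
  typesP2Q2 _ = []

  enum-typesP2Q2 : ∀ n → Enumerates (WithP2Q2 n) (typesP2Q2 n)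
  enum-typesP2Q2 0 = enum-[] (λ _ w → from-no (5 ≤? 0) (size≥5 (proj₁ (proj₁ w))))
  enum-typesP2Q2 1 = enum-[] (λ _ w → from-no (5 ≤? 1) (size≥5 (proj₁ (proj₁ w))))
  enum-typesP2Q2 2 = enum-[] (λ _ w → from-no (5 ≤? 2) (size≥5 (proj₁ (proj₁ w))))
  enum-typesP2Q2 3 = enum-[] (λ _ w → from-no (5 ≤? 3) (size≥5 (proj₁ (proj₁ w))))
  enum-typesP2Q2 4 = enum-[] (λ _ w → from-no (5 ≤? 4) (size≥5 (proj₁ (proj₁ w))))
  enum-typesP2Q2 (suc (suc (suc (suc (suc k))))) =
    enum-map typeP2Q2 (λ { {s , t} refl → refl }) (enum-pairs (suc k)) maps-to onto
    where
    total22 : ∀ s t → 2 + s + 2 + t ≡ 4 + (s + t)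
    total22 = solve-∀
    maps-to : ∀ st → SumsTo (suc k) st × Ok st → WithP2Q2 (5 + k) (typeP2Q2 st)
    maps-to (s , t) (e , ok) =
      (admissible ≤-refl ≤-refl (subst (1 ≤_) (sym e) (s≤s z≤n)) (trans (total22 s t) (cong (4 +_) e)) , refl , ok) , refl
    onto : ∀ u → WithP2Q2 (5 + k) u → Σ (ℕ × ℕ) (λ st → (SumsTo (suc k) st × Ok st) × u ≡ typeP2Q2 st)
    onto (gaps .2 s .2 t) ((admissible _ _ _ e , refl , ok) , refl) =
      (s , t) , (+-cancelˡ-≡ 4 (s + t) (suc k) (trans (sym (total22 s t)) e) , ok) , refl

  enum-incQ : ∀ {n xs} → Enumerates (WithP2 n) xs →
              Enumerates (λ u → WithP2 (suc n) u × 3 ≤ Q u) (map incQ xs)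
  enum-incQ {n} E = enum-map incQ incQ-injective E maps-to onto
    where
    maps-to : ∀ u → WithP2 n u → WithP2 (suc n) (incQ u) × 3 ≤ Q (incQ u)
    maps-to (gaps p s q t) (A , p≡2 , ok) = (admissible-incQ A , p≡2 , ok) , s≤s (2≤Q A)
    onto : ∀ u → WithP2 (suc n) u × 3 ≤ Q u → Σ Gaps (λ v → WithP2 n v × u ≡ incQ v)
    onto (gaps p s (suc q) t) ((A , p≡2 , ok) , s≤s 2≤q) = gaps p s q t , (admissible-decQ 2≤q A , p≡2 , ok) , refl

  typesP2 : ℕ → List Gaps
  typesP2 zero    = []
  typesP2 (suc n) = map incQ (typesP2 n) ++ typesP2Q2 (suc n)

  enum-typesP2 : ∀ n → Enumerates (WithP2 n) (typesP2 n)
  enum-typesP2 zero = enum-[] (λ _ w → from-no (5 ≤? 0) (size≥5 (proj₁ w)))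
  enum-typesP2 (suc n) =
    enum-++ (enum-incQ (enum-typesP2 n)) (enum-typesP2Q2 (suc n))
      (λ _ (_ , 3≤q) (_ , q≡2) → <-irrefl (sym q≡2) 3≤q) (λ _ → proj₁) (λ _ → proj₁) split
    where
    split : ∀ u → WithP2 (suc n) u → (WithP2 (suc n) u × 3 ≤ Q u) ⊎ WithP2Q2 (suc n) u
    split u w with Q u ≟ 2
    ... | yes q≡2 = inj₂ (w , q≡2)
    ... | no  q≢2 = inj₁ (w , ≤∧≢⇒< (2≤Q (proj₁ w)) (λ 2≡q → q≢2 (sym 2≡q)))

  length-typesP2 : ∀ n → length (typesP2 (suc n)) ≡ length (typesP2 n) + length (typesP2Q2 (suc n))
  length-typesP2 n =
    trans (length-++ (map incQ (typesP2 n))) (cong (_+ length (typesP2Q2 (suc n))) (length-map incQ (typesP2 n)))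

module AnyP2      = TypesP2 (λ _ → ⊤) splits (λ k → enum-⇔ (λ _ e → e , tt) (λ _ → proj₁) (enum-splits k))
module BalancedP2 = TypesP2 Balanced balancedSplits enum-balancedSplits

-- Canonical representatives of the orbits of ⟨σ⟩ (these will be the rotation
-- classes) and of ⟨σ , ρ⟩ (the dihedral classes).
CanonZ : Gaps → Set
CanonZ u = P u < Q u ⊎ (P u ≡ Q u × S u ≤ T u)

CanonD : Gaps → Set
CanonD u = P u ≤ Q u × S u ≤ T u

canonZ-P≤Q : ∀ u → CanonZ u → P u ≤ Q u
canonZ-P≤Q u (inj₁ p<q)     = <⇒≤ p<q
canonZ-P≤Q u (inj₂ (p≡q , _)) = ≤-reflexive p≡q

canonZ-total : ∀ u → CanonZ u ⊎ CanonZ (σ u)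
canonZ-total u with <-cmp (P u) (Q u)
... | tri< p<q _ _ = inj₁ (inj₁ p<q)
... | tri> _ _ q<p = inj₂ (inj₁ q<p)
... | tri≈ _ p≡q _ with ≤-total (S u) (T u)
...   | inj₁ s≤t = inj₁ (inj₂ (p≡q , s≤t))
...   | inj₂ t≤s = inj₂ (inj₂ (sym p≡q , t≤s))

canonZ-unique : ∀ u → CanonZ u → CanonZ (σ u) → σ u ≡ u
canonZ-unique (gaps p s q t) (inj₁ p<q)     (inj₁ q<p)     = ⊥-elim (<-asym p<q q<p)
canonZ-unique (gaps p s q t) (inj₁ p<q)     (inj₂ (q≡p , _)) = ⊥-elim (<-irrefl (sym q≡p) p<q)
canonZ-unique (gaps p s q t) (inj₂ (p≡q , _)) (inj₁ q<p)     = ⊥-elim (<-irrefl (sym p≡q) q<p)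
canonZ-unique (gaps p s .p t) (inj₂ (refl , s≤t)) (inj₂ (_ , t≤s)) with ≤-antisym s≤t t≤s
... | refl = refl

canonD-total : ∀ u → CanonD u ⊎ CanonD (σ u) ⊎ CanonD (ρ u) ⊎ CanonD (σ (ρ u))
canonD-total u with ≤-total (P u) (Q u) | ≤-total (S u) (T u)
... | inj₁ p≤q | inj₁ s≤t = inj₁ (p≤q , s≤t)
... | inj₂ q≤p | inj₂ t≤s = inj₂ (inj₁ (q≤p , t≤s))
... | inj₁ p≤q | inj₂ t≤s = inj₂ (inj₂ (inj₁ (p≤q , t≤s)))
... | inj₂ q≤p | inj₁ s≤t = inj₂ (inj₂ (inj₂ (q≤p , s≤t)))

canonD-unique : ∀ {x y} → CanonD x → CanonD y → (x ≡ y ⊎ x ≡ σ y) ⊎ (ρ x ≡ y ⊎ ρ x ≡ σ y) → x ≡ y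
canonD-unique _ _ (inj₁ (inj₁ x≡y)) = x≡y
canonD-unique {y = gaps p s q t} (q≤p , t≤s) (p≤q , s≤t) (inj₁ (inj₂ refl))
  with ≤-antisym p≤q q≤p | ≤-antisym s≤t t≤s
... | refl | refl = refl
canonD-unique {x = gaps p s q t} (_ , s≤t) (_ , t≤s) (inj₂ (inj₁ refl)) with ≤-antisym s≤t t≤s
... | refl = refl
canonD-unique {x = gaps p s q t} {gaps _ _ _ _} (p≤q , _) (q≤p , _) (inj₂ (inj₂ refl)) with ≤-antisym p≤q q≤p
... | refl = refl

enum-shift : ∀ {n xs} {C : Gaps → Set} → (∀ u → C u → C (shift u)) → (∀ u → C (shift u) → C u) →
             (∀ u → C u → P u ≤ Q u) → Enumerates (λ u → Admissible n u × C u) xs →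
             Enumerates (λ u → (Admissible (2 + n) u × C u) × 3 ≤ P u) (map shift xs)
enum-shift {n} {C = C} C-shift C-unshift C-P≤Q E = enum-map shift shift-injective E maps-to onto
  where
  maps-to : ∀ u → Admissible n u × C u → (Admissible (2 + n) (shift u) × C (shift u)) × 3 ≤ P (shift u)
  maps-to (gaps p s q t) (A , c) = (admissible-shift A , C-shift _ c) , s≤s (2≤P A)
  onto : ∀ u → (Admissible (2 + n) u × C u) × 3 ≤ P u → Σ Gaps (λ v → (Admissible n v × C v) × u ≡ shift v)
  onto (gaps (suc p) s zero t) ((admissible _ () _ _ , _) , _)
  onto (gaps (suc p) s (suc q) t) ((A , c) , s≤s 2≤p) =
    gaps p s q t , (admissible-unshift 2≤p (≤-trans 2≤p (≤-pred (C-P≤Q _ c))) A , C-unshift (gaps p s q t) c) , refl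

canonicalZ : ℕ → List Gaps
canonicalZ zero                = []
canonicalZ (suc zero)          = []
canonicalZ (suc (suc n))       =
  map shift (canonicalZ n) ++ (map incQ (AnyP2.typesP2 (suc n)) ++ BalancedP2.typesP2Q2 (suc (suc n)))

enum-canonicalZ : ∀ n → Enumerates (λ u → Admissible n u × CanonZ u) (canonicalZ n)
enum-canonicalZ zero       = enum-[] (λ _ w → from-no (5 ≤? 0) (size≥5 (proj₁ w)))
enum-canonicalZ (suc zero) = enum-[] (λ _ w → from-no (5 ≤? 1) (size≥5 (proj₁ w)))
enum-canonicalZ (suc (suc n)) =
  enum-++ (enum-shift shiftZ unshiftZ canonZ-P≤Q (enum-canonicalZ n))
    (enum-++ (AnyP2.enum-incQ (AnyP2.enum-typesP2 (suc n))) (BalancedP2.enum-typesP2Q2 (suc (suc n)))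
       (λ _ (_ , 3≤q) (_ , q≡2) → <-irrefl (sym q≡2) 3≤q)
       (λ { u ((A , p≡2 , _) , 3≤q) → (A , inj₁ (subst (_< Q u) (sym p≡2) 3≤q)) , p≡2 })
       (λ { u ((A , p≡2 , s≤t) , q≡2) → (A , inj₂ (trans p≡2 (sym q≡2) , s≤t)) , p≡2 })
       splitP2)
    (λ _ (_ , 3≤p) (_ , p≡2) → <-irrefl (sym p≡2) 3≤p) (λ _ → proj₁) (λ _ → proj₁) splitP
  where
  shiftZ : ∀ u → CanonZ u → CanonZ (shift u)
  shiftZ (gaps p s q t) (inj₁ p<q)         = inj₁ (s≤s p<q)
  shiftZ (gaps p s q t) (inj₂ (p≡q , s≤t)) = inj₂ (cong suc p≡q , s≤t)
  unshiftZ : ∀ u → CanonZ (shift u) → CanonZ u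
  unshiftZ (gaps p s q t) (inj₁ (s≤s p<q))   = inj₁ p<q
  unshiftZ (gaps p s q t) (inj₂ (p≡q , s≤t)) = inj₂ (suc-injective p≡q , s≤t)
  N = suc (suc n)
  splitP : ∀ u → Admissible N u × CanonZ u → ((Admissible N u × CanonZ u) × 3 ≤ P u) ⊎ ((Admissible N u × CanonZ u) × P u ≡ 2)
  splitP u w with P u ≟ 2
  ... | yes p≡2 = inj₂ (w , p≡2)
  ... | no  p≢2 = inj₁ (w , ≤∧≢⇒< (2≤P (proj₁ w)) (λ 2≡p → p≢2 (sym 2≡p)))
  splitP2 : ∀ u → (Admissible N u × CanonZ u) × P u ≡ 2 → (AnyP2.WithP2 N u × 3 ≤ Q u) ⊎ BalancedP2.WithP2Q2 N u
  splitP2 u ((A , c) , p≡2) with Q u ≟ 2 | c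
  ... | no  q≢2 | _            = inj₁ ((A , p≡2 , tt) , ≤∧≢⇒< (2≤Q A) (λ 2≡q → q≢2 (sym 2≡q)))
  ... | yes q≡2 | inj₁ p<q     = ⊥-elim (<-irrefl (trans p≡2 (sym q≡2)) p<q)
  ... | yes q≡2 | inj₂ (_ , s≤t) = inj₂ ((A , p≡2 , s≤t) , q≡2)

canonicalD : ℕ → List Gaps
canonicalD zero          = []
canonicalD (suc zero)    = []
canonicalD (suc (suc n)) = map shift (canonicalD n) ++ BalancedP2.typesP2 (suc (suc n))

enum-canonicalD : ∀ n → Enumerates (λ u → Admissible n u × CanonD u) (canonicalD n)
enum-canonicalD zero       = enum-[] (λ _ w → from-no (5 ≤? 0) (size≥5 (proj₁ w)))
enum-canonicalD (suc zero) = enum-[] (λ _ w → from-no (5 ≤? 1) (size≥5 (proj₁ w)))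
enum-canonicalD (suc (suc n)) =
  enum-++ (enum-shift shiftD unshiftD (λ _ → proj₁) (enum-canonicalD n)) (BalancedP2.enum-typesP2 N)
    (λ _ (_ , 3≤p) (_ , p≡2 , _) → <-irrefl (sym p≡2) 3≤p)
    (λ _ → proj₁) (λ { u (A , p≡2 , s≤t) → A , subst (_≤ Q u) (sym p≡2) (2≤Q A) , s≤t }) splitP
  where
  N = suc (suc n)
  shiftD : ∀ u → CanonD u → CanonD (shift u)
  shiftD (gaps p s q t) (p≤q , s≤t) = s≤s p≤q , s≤t
  unshiftD : ∀ u → CanonD (shift u) → CanonD u
  unshiftD (gaps p s q t) (s≤s p≤q , s≤t) = p≤q , s≤t
  splitP : ∀ u → Admissible N u × CanonD u → ((Admissible N u × CanonD u) × 3 ≤ P u) ⊎ BalancedP2.WithP2 N u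
  splitP u (A , p≤q , s≤t) with P u ≟ 2
  ... | yes p≡2 = inj₂ (A , p≡2 , s≤t)
  ... | no  p≢2 = inj₁ ((A , p≤q , s≤t) , ≤∧≢⇒< (2≤P A) (λ 2≡p → p≢2 (sym 2≡p)))

length-balancedSplits-step : ∀ k → length (balancedSplits (2 + k)) ≡ suc (length (balancedSplits k))
length-balancedSplits-step k = cong suc (length-map incBoth (balancedSplits k))

length-balancedP2Q2 : ∀ k → length (BalancedP2.typesP2Q2 (5 + k)) ≡ length (balancedSplits (suc k))
length-balancedP2Q2 k = length-map BalancedP2.typeP2Q2 (balancedSplits (suc k))

length-anyP2 : ∀ k → 2 * length (AnyP2.typesP2 (5 + k)) ≡ (k + 1) * (k + 4)
length-anyP2 zero    = refl
length-anyP2 (suc k) = begin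
  2 * length (AnyP2.typesP2 (6 + k))       ≡⟨ cong (2 *_) (AnyP2.length-typesP2 (5 + k)) ⟩
  2 * (L + length (AnyP2.typesP2Q2 (6 + k))) ≡⟨ cong (λ x → 2 * (L + x)) newTypes ⟩
  2 * (L + (3 + k))                         ≡⟨ *-distribˡ-+ 2 L (3 + k) ⟩
  2 * L + 2 * (3 + k)                       ≡⟨ cong (_+ 2 * (3 + k)) (length-anyP2 k) ⟩
  (k + 1) * (k + 4) + 2 * (3 + k)           ≡⟨ closedForm k ⟩
  (suc k + 1) * (suc k + 4)                 ∎
  where
  L = length (AnyP2.typesP2 (5 + k))
  newTypes : length (AnyP2.typesP2Q2 (6 + k)) ≡ 3 + k
  newTypes = trans (length-map AnyP2.typeP2Q2 (splits (2 + k))) (length-splits (2 + k))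
  closedForm : ∀ k → (k + 1) * (k + 4) + 2 * (3 + k) ≡ (suc k + 1) * (suc k + 4)
  closedForm = solve-∀

length-balancedP2Q2-even : ∀ j → length (BalancedP2.typesP2Q2 (6 + (j + j))) ≡ 2 + j
length-balancedP2Q2-even j =
  trans (length-balancedP2Q2 (suc (j + j)))
    (trans (length-balancedSplits-step (j + j)) (cong suc (length-balanced-even j)))

length-balancedP2Q2-odd : ∀ j → length (BalancedP2.typesP2Q2 (7 + (j + j))) ≡ 2 + j
length-balancedP2Q2-odd j =
  trans (length-balancedP2Q2 (2 + (j + j)))
    (trans (length-balancedSplits-step (suc (j + j))) (cong suc (length-balanced-odd j)))

length-balancedP2 : ∀ j → (length (BalancedP2.typesP2 (5 + (j + j))) + 1 ≡ (j + 1) * (j + 2))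
                        × (length (BalancedP2.typesP2 (6 + (j + j))) ≡ (j + 1) * (j + 3))
length-balancedP2 zero = refl , refl
length-balancedP2 (suc j) rewrite +-suc j j = odd , even
  where
  L6 = length (BalancedP2.typesP2 (6 + (j + j)))
  L7 = length (BalancedP2.typesP2 (7 + (j + j)))
  L8 = length (BalancedP2.typesP2 (8 + (j + j)))
  new8 : length (BalancedP2.typesP2Q2 (8 + (j + j))) ≡ 3 + j
  new8 = trans (length-balancedP2Q2 (3 + (j + j)))
           (trans (length-balancedSplits-step (2 + (j + j)))
             (cong suc (trans (length-balancedSplits-step (j + j)) (cong suc (length-balanced-even j)))))
  odd : L7 + 1 ≡ (suc j + 1) * (suc j + 2)
  odd = begin
    L7 + 1
      ≡⟨ cong (_+ 1) (BalancedP2.length-typesP2 (6 + (j + j))) ⟩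
    L6 + length (BalancedP2.typesP2Q2 (7 + (j + j))) + 1
      ≡⟨ cong₂ (λ x y → x + y + 1) (proj₂ (length-balancedP2 j)) (length-balancedP2Q2-odd j) ⟩
    (j + 1) * (j + 3) + (2 + j) + 1
      ≡⟨ closedForm j ⟩
    (suc j + 1) * (suc j + 2) ∎
    where
    closedForm : ∀ j → (j + 1) * (j + 3) + (2 + j) + 1 ≡ (suc j + 1) * (suc j + 2)
    closedForm = solve-∀
  even : L8 ≡ (suc j + 1) * (suc j + 3)
  even = +-cancelʳ-≡ 1 L8 _ (begin
    L8 + 1                            ≡⟨ cong (_+ 1) (BalancedP2.length-typesP2 (7 + (j + j))) ⟩
    L7 + length (BalancedP2.typesP2Q2 (8 + (j + j))) + 1 ≡⟨ cong (λ x → L7 + x + 1) new8 ⟩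
    L7 + (3 + j) + 1                  ≡⟨ regroup L7 j ⟩
    (L7 + 1) + (3 + j)                ≡⟨ cong (_+ (3 + j)) odd ⟩
    (suc j + 1) * (suc j + 2) + (3 + j) ≡⟨ closedForm j ⟩
    (suc j + 1) * (suc j + 3) + 1     ∎)
    where
    regroup : ∀ x j → x + (3 + j) + 1 ≡ (x + 1) + (3 + j)
    regroup = solve-∀
    closedForm : ∀ j → (suc j + 1) * (suc j + 2) + (3 + j) ≡ (suc j + 1) * (suc j + 3) + 1
    closedForm = solve-∀

length-canonicalZ-step : ∀ n → length (canonicalZ (2 + n)) ≡
  length (canonicalZ n) + (length (AnyP2.typesP2 (suc n)) + length (BalancedP2.typesP2Q2 (2 + n)))
length-canonicalZ-step n =
  trans (length-++ (map shift (canonicalZ n)))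
    (cong₂ _+_ (length-map shift (canonicalZ n))
      (trans (length-++ (map incQ (AnyP2.typesP2 (suc n))))
        (cong (_+ length (BalancedP2.typesP2Q2 (2 + n))) (length-map incQ (AnyP2.typesP2 (suc n))))))

length-canonicalD-step : ∀ n → length (canonicalD (2 + n)) ≡ length (canonicalD n) + length (BalancedP2.typesP2 (2 + n))
length-canonicalD-step n =
  trans (length-++ (map shift (canonicalD n)))
    (cong (_+ length (BalancedP2.typesP2 (2 + n))) (length-map shift (canonicalD n)))

count-Z-even : ∀ j → 12 * length (canonicalZ (4 + (j + j))) ≡ (4 + (j + j)) * (2 + (j + j)) * (j + j)
count-Z-even zero    = refl
count-Z-even (suc j) rewrite +-suc j j = begin
  12 * length (canonicalZ (6 + (j + j)))
    ≡⟨ cong (12 *_) (length-canonicalZ-step (4 + (j + j))) ⟩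
  12 * (C + (A + B))
    ≡⟨ regroup C A B ⟩
  12 * C + 6 * (2 * A) + 12 * B
    ≡⟨ cong₂ (λ x y → x + 6 * y + 12 * B) (count-Z-even j) (length-anyP2 (j + j)) ⟩
  c₀ + 6 * a₀ + 12 * B
    ≡⟨ cong (λ y → c₀ + 6 * a₀ + 12 * y) (length-balancedP2Q2-even j) ⟩
  c₀ + 6 * a₀ + 12 * (2 + j)
    ≡⟨ closedForm j ⟩
  (6 + (j + j)) * (4 + (j + j)) * (2 + (j + j)) ∎
  where
  C = length (canonicalZ (4 + (j + j)))
  A = length (AnyP2.typesP2 (5 + (j + j)))
  B = length (BalancedP2.typesP2Q2 (6 + (j + j)))
  c₀ = (4 + (j + j)) * (2 + (j + j)) * (j + j)
  a₀ = (j + j + 1) * (j + j + 4)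
  regroup : ∀ c a b → 12 * (c + (a + b)) ≡ 12 * c + 6 * (2 * a) + 12 * b
  regroup = solve-∀
  closedForm : ∀ j → (4 + (j + j)) * (2 + (j + j)) * (j + j) + 6 * ((j + j + 1) * (j + j + 4)) + 12 * (2 + j)
                     ≡ (6 + (j + j)) * (4 + (j + j)) * (2 + (j + j))
  closedForm = solve-∀

count-Z-odd : ∀ j → 12 * length (canonicalZ (5 + (j + j))) ≡ (5 + (j + j) + 1) * (2 + (j + j)) * (1 + (j + j))
count-Z-odd zero    = refl
count-Z-odd (suc j) rewrite +-suc j j = begin
  12 * length (canonicalZ (7 + (j + j)))
    ≡⟨ cong (12 *_) (length-canonicalZ-step (5 + (j + j))) ⟩
  12 * (C + (A + B))
    ≡⟨ regroup C A B ⟩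
  12 * C + 6 * (2 * A) + 12 * B
    ≡⟨ cong₂ (λ x y → x + 6 * y + 12 * B) (count-Z-odd j) (length-anyP2 (suc (j + j))) ⟩
  c₀ + 6 * a₀ + 12 * B
    ≡⟨ cong (λ y → c₀ + 6 * a₀ + 12 * y) (length-balancedP2Q2-odd j) ⟩
  c₀ + 6 * a₀ + 12 * (2 + j)
    ≡⟨ closedForm j ⟩
  (7 + (j + j) + 1) * (4 + (j + j)) * (3 + (j + j)) ∎
  where
  C = length (canonicalZ (5 + (j + j)))
  A = length (AnyP2.typesP2 (6 + (j + j)))
  B = length (BalancedP2.typesP2Q2 (7 + (j + j)))
  c₀ = (5 + (j + j) + 1) * (2 + (j + j)) * (1 + (j + j))
  a₀ = (suc (j + j) + 1) * (suc (j + j) + 4)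
  regroup : ∀ c a b → 12 * (c + (a + b)) ≡ 12 * c + 6 * (2 * a) + 12 * b
  regroup = solve-∀
  closedForm : ∀ j → (5 + (j + j) + 1) * (2 + (j + j)) * (1 + (j + j)) + 6 * ((suc (j + j) + 1) * (suc (j + j) + 4))
                       + 12 * (2 + j)
                     ≡ (7 + (j + j) + 1) * (4 + (j + j)) * (3 + (j + j))
  closedForm = solve-∀

count-D-even : ∀ j → 24 * length (canonicalD (4 + (j + j))) ≡ (j + j) * (2 + (j + j)) * (4 + (j + j) + 3)
count-D-even zero    = refl
count-D-even (suc j) rewrite +-suc j j = begin
  24 * length (canonicalD (6 + (j + j)))
    ≡⟨ cong (24 *_) (length-canonicalD-step (4 + (j + j))) ⟩
  24 * (C + B)
    ≡⟨ *-distribˡ-+ 24 C B ⟩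
  24 * C + 24 * B
    ≡⟨ cong₂ (λ c b → c + 24 * b) (count-D-even j) (proj₂ (length-balancedP2 j)) ⟩
  (j + j) * (2 + (j + j)) * (4 + (j + j) + 3) + 24 * ((j + 1) * (j + 3))
    ≡⟨ closedForm j ⟩
  (2 + (j + j)) * (4 + (j + j)) * (6 + (j + j) + 3) ∎
  where
  C = length (canonicalD (4 + (j + j)))
  B = length (BalancedP2.typesP2 (6 + (j + j)))
  closedForm : ∀ j → (j + j) * (2 + (j + j)) * (4 + (j + j) + 3) + 24 * ((j + 1) * (j + 3))
                     ≡ (2 + (j + j)) * (4 + (j + j)) * (6 + (j + j) + 3)
  closedForm = solve-∀

-- The odd case is proved with (5 + 2j)² - 13 in polynomial form.
count-D-odd-polynomial : ∀ j → 24 * length (canonicalD (5 + (j + j))) ≡ (2 + (j + j)) * (12 + 20 * j + 4 * (j * j))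
count-D-odd-polynomial zero    = refl
count-D-odd-polynomial (suc j) rewrite +-suc j j = +-cancelʳ-≡ 24 _ _ (begin
  24 * length (canonicalD (7 + (j + j))) + 24
    ≡⟨ cong (λ x → 24 * x + 24) (length-canonicalD-step (5 + (j + j))) ⟩
  24 * (C + B) + 24
    ≡⟨ regroup C B ⟩
  24 * C + 24 * (B + 1)
    ≡⟨ cong₂ (λ c b → c + 24 * b) (count-D-odd-polynomial j) B+1 ⟩
  (2 + (j + j)) * (12 + 20 * j + 4 * (j * j)) + 24 * ((suc j + 1) * (suc j + 2))
    ≡⟨ closedForm j ⟩
  (4 + (j + j)) * (12 + 20 * suc j + 4 * (suc j * suc j)) + 24 ∎)
  where
  C = length (canonicalD (5 + (j + j)))
  B = length (BalancedP2.typesP2 (7 + (j + j)))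
  B+1 : B + 1 ≡ (suc j + 1) * (suc j + 2)
  B+1 = subst (λ k → length (BalancedP2.typesP2 (5 + k)) + 1 ≡ (suc j + 1) * (suc j + 2))
              (cong suc (+-suc j j)) (proj₁ (length-balancedP2 (suc j)))
  regroup : ∀ c b → 24 * (c + b) + 24 ≡ 24 * c + 24 * (b + 1)
  regroup = solve-∀
  closedForm : ∀ j → (2 + (j + j)) * (12 + 20 * j + 4 * (j * j)) + 24 * ((suc j + 1) * (suc j + 2))
                     ≡ (4 + (j + j)) * (12 + 20 * suc j + 4 * (suc j * suc j)) + 24
  closedForm = solve-∀

count-D-odd : ∀ j → 24 * length (canonicalD (5 + (j + j))) ≡ (2 + (j + j)) * ((5 + (j + j)) * (5 + (j + j)) ∸ 13)
count-D-odd j = trans (count-D-odd-polynomial j) (cong ((2 + (j + j)) *_) (sym square∸13))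
  where
  square : ∀ j → (5 + (j + j)) * (5 + (j + j)) ≡ (12 + 20 * j + 4 * (j * j)) + 13
  square = solve-∀
  square∸13 : (5 + (j + j)) * (5 + (j + j)) ∸ 13 ≡ 12 + 20 * j + 4 * (j * j)
  square∸13 = trans (cong (_∸ 13) (square j)) (m+n∸n≡m _ 13)

module _ {A B : Set} {R : A → Set} where

  mapAll : (xs : List A) → All R xs → (∀ x → R x → B) → List B
  mapAll []       []       f = []
  mapAll (x ∷ xs) (r ∷ rs) f = f x r ∷ mapAll xs rs f

  length-mapAll : ∀ xs rs f → length (mapAll xs rs f) ≡ length xs
  length-mapAll []       []       f = refl
  length-mapAll (x ∷ xs) (r ∷ rs) f = cong suc (length-mapAll xs rs f)

  mapAll-any : ∀ {Q : B → Set} xs rs f {x} → x ∈ xs → (∀ r → Q (f x r)) → Any Q (mapAll xs rs f)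
  mapAll-any (y ∷ xs) (r ∷ rs) f (here refl) q = here (q r)
  mapAll-any (y ∷ xs) (r ∷ rs) f (there x∈) q = there (mapAll-any xs rs f x∈ q)

  mapAll-pairs : ∀ {Q : B → B → Set} xs rs f → AllPairs (λ x y → ∀ rx ry → Q (f x rx) (f y ry)) xs →
                 AllPairs Q (mapAll xs rs f)
  mapAll-pairs []       []       f []       = []
  mapAll-pairs {Q} (x ∷ xs) (r ∷ rs) f (h ∷ hs) = heads xs rs h ∷ mapAll-pairs xs rs f hs
    where
    heads : ∀ ys ss → All (λ y → ∀ rx ry → Q (f x rx) (f y ry)) ys → All (Q (f x r)) (mapAll ys ss f)
    heads []       []       []       = []
    heads (y ∷ ys) (s ∷ ss) (k ∷ ks) = k r s ∷ heads ys ss ks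

module Polygon (m : ℕ) where

  N : ℕ
  N = suc m

  dist : ℕ → ℕ → ℕ
  dist x y = (y + (N ∸ x)) % N

  %-absorbʳ : ∀ a b → (a + b % N) % N ≡ (a + b) % N
  %-absorbʳ a b = begin
    (a + b % N) % N           ≡⟨ %-distribˡ-+ a (b % N) N ⟩
    (a % N + b % N % N) % N   ≡⟨ cong (λ z → (a % N + z) % N) (m%n%n≡m%n b N) ⟩
    (a % N + b % N) % N       ≡⟨ %-distribˡ-+ a b N ⟨
    (a + b) % N               ∎

  %-absorbˡ : ∀ a b → (a % N + b) % N ≡ (a + b) % N
  %-absorbˡ a b = begin
    (a % N + b) % N ≡⟨ cong (_% N) (+-comm (a % N) b) ⟩
    (b + a % N) % N ≡⟨ %-absorbʳ b a ⟩
    (b + a) % N     ≡⟨ cong (_% N) (+-comm b a) ⟩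
    (a + b) % N     ∎

  %-cancelʳ : ∀ a b c → (a + c) % N ≡ (b + c) % N → a % N ≡ b % N
  %-cancelʳ a b c e = begin
    a % N                     ≡⟨ [m+kn]%n≡m%n a (suc (c / N)) N ⟨
    (a + suc (c / N) * N) % N ≡⟨ cong (λ z → (a + z) % N) c+w ⟨
    (a + (c + w)) % N         ≡⟨ cong (_% N) (+-assoc a c w) ⟨
    (a + c + w) % N           ≡⟨ %-absorbˡ (a + c) w ⟨
    ((a + c) % N + w) % N     ≡⟨ cong (λ z → (z + w) % N) e ⟩
    ((b + c) % N + w) % N     ≡⟨ %-absorbˡ (b + c) w ⟩
    (b + c + w) % N           ≡⟨ cong (_% N) (+-assoc b c w) ⟩
    (b + (c + w)) % N         ≡⟨ cong (λ z → (b + z) % N) c+w ⟩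
    (b + suc (c / N) * N) % N ≡⟨ [m+kn]%n≡m%n b (suc (c / N)) N ⟩
    b % N                     ∎
    where
    -- w complements c to a multiple of N
    w = N ∸ c % N
    c+w : c + w ≡ suc (c / N) * N
    c+w = begin
      c + w                     ≡⟨ cong (_+ w) (m≡m%n+[m/n]*n c N) ⟩
      c % N + c / N * N + w     ≡⟨ cong (_+ w) (+-comm (c % N) _) ⟩
      c / N * N + c % N + w     ≡⟨ +-assoc (c / N * N) (c % N) w ⟩
      c / N * N + (c % N + w)   ≡⟨ cong (c / N * N +_) (m+[n∸m]≡n (m%n≤n c N)) ⟩
      c / N * N + N             ≡⟨ +-comm (c / N * N) N ⟩
      suc (c / N) * N           ∎

  dist<N : ∀ x y → dist x y < N
  dist<N x y = m%n<n (y + (N ∸ x)) N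

  dist-reaches : ∀ x y → x ≤ N → (x + dist x y) % N ≡ y % N
  dist-reaches x y x≤N = begin
    (x + dist x y) % N        ≡⟨ %-absorbʳ x (y + (N ∸ x)) ⟩
    (x + (y + (N ∸ x))) % N   ≡⟨ cong (_% N) (x+[y+z]≡y+[x+z] x y (N ∸ x)) ⟩
    (y + (x + (N ∸ x))) % N   ≡⟨ cong (λ z → (y + z) % N) (m+[n∸m]≡n x≤N) ⟩
    (y + N) % N               ≡⟨ [m+n]%n≡m%n y N ⟩
    y % N                     ∎
    where
    x+[y+z]≡y+[x+z] : ∀ x y z → x + (y + z) ≡ y + (x + z)
    x+[y+z]≡y+[x+z] = solve-∀

  dist-unique : ∀ x y k → k < N → x ≤ N → (x + k) % N ≡ y % N → dist x y ≡ k
  dist-unique x y k k<N x≤N e = begin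
    (y + (N ∸ x)) % N         ≡⟨ %-absorbˡ y (N ∸ x) ⟨
    (y % N + (N ∸ x)) % N     ≡⟨ cong (λ z → (z + (N ∸ x)) % N) e ⟨
    ((x + k) % N + (N ∸ x)) % N ≡⟨ %-absorbˡ (x + k) (N ∸ x) ⟩
    (x + k + (N ∸ x)) % N     ≡⟨ cong (_% N) (x+k+z≡k+[x+z] x k (N ∸ x)) ⟩
    (k + (x + (N ∸ x))) % N   ≡⟨ cong (λ z → (k + z) % N) (m+[n∸m]≡n x≤N) ⟩
    (k + N) % N               ≡⟨ [m+n]%n≡m%n k N ⟩
    k % N                     ≡⟨ m<n⇒m%n≡m k<N ⟩
    k                         ∎
    where
    x+k+z≡k+[x+z] : ∀ x k z → x + k + z ≡ k + (x + z)
    x+k+z≡k+[x+z] = solve-∀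

  dist-injective : ∀ {x y z} → x ≤ N → y < N → z < N → dist x y ≡ dist x z → y ≡ z
  dist-injective {x} {y} {z} x≤N y<N z<N e = begin
    y                  ≡⟨ m<n⇒m%n≡m y<N ⟨
    y % N              ≡⟨ dist-reaches x y x≤N ⟨
    (x + dist x y) % N ≡⟨ cong (λ k → (x + k) % N) e ⟩
    (x + dist x z) % N ≡⟨ dist-reaches x z x≤N ⟩
    z % N              ≡⟨ m<n⇒m%n≡m z<N ⟩
    z                  ∎

  dist-self : ∀ x → x ≤ N → dist x x ≡ 0
  dist-self x x≤N = dist-unique x x 0 z<s x≤N (cong (_% N) (+-identityʳ x))

  dist-forward : ∀ {x y k} → x + k ≡ y → y < N → dist x y ≡ k
  dist-forward {x} {y} {k} e y<N =
    dist-unique x y k (≤-<-trans (subst (k ≤_) e (m≤n+m k x)) y<N)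
                      (<⇒≤ (≤-<-trans (subst (x ≤_) e (m≤m+n x k)) y<N)) (cong (_% N) e)

  dist-wrap : ∀ {x y k} → x + k ≡ y + N → k < N → x ≤ N → dist x y ≡ k
  dist-wrap {x} {y} {k} e k<N x≤N = dist-unique x y k k<N x≤N (trans (cong (_% N) e) ([m+n]%n≡m%n y N))

  dist-additive : ∀ x y z → x ≤ N → y ≤ N → dist x y + dist y z < N → dist x z ≡ dist x y + dist y z
  dist-additive x y z x≤N y≤N short = dist-unique x z _ short x≤N (begin
    (x + (dist x y + dist y z)) % N    ≡⟨ cong (_% N) (+-assoc x _ _) ⟨
    (x + dist x y + dist y z) % N      ≡⟨ %-absorbˡ (x + dist x y) _ ⟨
    ((x + dist x y) % N + dist y z) % N ≡⟨ cong (λ w → (w + dist y z) % N) (dist-reaches x y x≤N) ⟩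
    (y % N + dist y z) % N             ≡⟨ %-absorbˡ y _ ⟩
    (y + dist y z) % N                 ≡⟨ dist-reaches y z y≤N ⟩
    z % N                              ∎)

  detour : ∀ x y z → x ≤ N → y ≤ N → dist x z < dist x y → N ≤ dist x y + dist y z
  detour x y z x≤N y≤N passes with dist x y + dist y z <? N
  ... | no  long  = ≮⇒≥ long
  ... | yes short = ⊥-elim (<⇒≱ passes (subst (dist x y ≤_) (sym (dist-additive x y z x≤N y≤N short))
                                                  (m≤m+n (dist x y) (dist y z))))

  dist-rotate : ∀ r x y → x ≤ N → dist (actV N false r x) (actV N false r y) ≡ dist x y
  dist-rotate r x y x≤N =
    dist-unique ((x + r) % N) ((y + r) % N) (dist x y) (dist<N x y) (<⇒≤ (m%n<n (x + r) N)) (begin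
      ((x + r) % N + dist x y) % N ≡⟨ %-absorbˡ (x + r) (dist x y) ⟩
      (x + r + dist x y) % N       ≡⟨ cong (_% N) (x+r+d≡x+d+r x r (dist x y)) ⟩
      (x + dist x y + r) % N       ≡⟨ %-absorbˡ (x + dist x y) r ⟨
      ((x + dist x y) % N + r) % N ≡⟨ cong (λ z → (z + r) % N) (dist-reaches x y x≤N) ⟩
      (y % N + r) % N              ≡⟨ %-absorbˡ y r ⟩
      (y + r) % N                  ≡⟨ m%n%n≡m%n (y + r) N ⟨
      (y + r) % N % N              ∎)
    where
    x+r+d≡x+d+r : ∀ x r d → x + r + d ≡ x + d + r
    x+r+d≡x+d+r = solve-∀

  dist-reflect : ∀ r x y → x < N → y ≤ N → dist (actV N true r x) (actV N true r y) ≡ dist y x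
  dist-reflect r x y x<N y≤N =
    dist-unique (g x) (g y) k (dist<N y x) (<⇒≤ (m%n<n (r + (N ∸ x)) N)) (begin
      ((r + (N ∸ x)) % N + k) % N ≡⟨ %-absorbˡ (r + (N ∸ x)) k ⟩
      (r + (N ∸ x) + k) % N       ≡⟨ cong (_% N) (+-assoc r (N ∸ x) k) ⟩
      (r + ((N ∸ x) + k)) % N     ≡⟨ %-absorbʳ r ((N ∸ x) + k) ⟨
      (r + ((N ∸ x) + k) % N) % N ≡⟨ cong (λ z → (r + z) % N) key ⟩
      (r + (N ∸ y) % N) % N       ≡⟨ %-absorbʳ r (N ∸ y) ⟩
      (r + (N ∸ y)) % N           ≡⟨ m%n%n≡m%n (r + (N ∸ y)) N ⟨
      (r + (N ∸ y)) % N % N       ∎)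
    where
    g = actV N true r
    k = dist y x
    -- N - x + dist y x ≡ N - y, because y + dist y x ≡ x
    key : ((N ∸ x) + k) % N ≡ (N ∸ y) % N
    key = %-cancelʳ ((N ∸ x) + k) (N ∸ y) y (begin
      ((N ∸ x) + k + y) % N       ≡⟨ cong (_% N) (trans (+-assoc (N ∸ x) k y) (cong ((N ∸ x) +_) (+-comm k y))) ⟩
      ((N ∸ x) + (y + k)) % N     ≡⟨ %-absorbʳ (N ∸ x) (y + k) ⟨
      ((N ∸ x) + (y + k) % N) % N ≡⟨ cong (λ z → ((N ∸ x) + z) % N) (trans (dist-reaches y x y≤N) (m<n⇒m%n≡m x<N)) ⟩
      ((N ∸ x) + x) % N           ≡⟨ cong (_% N) (m∸n+n≡m (<⇒≤ x<N)) ⟩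
      N % N                       ≡⟨ cong (_% N) (m∸n+n≡m y≤N) ⟨
      ((N ∸ y) + y) % N           ∎)

  data Ends (x y : ℕ) (d : Diagonal N) : Set where
    fwd : x ≡ a d → y ≡ b d → Ends x y d
    bwd : x ≡ b d → y ≡ a d → Ends x y d

  data Endpoints (X : Dissection2 N) (x₁ y₁ x₂ y₂ : ℕ) : Set where
    as12 : Ends x₁ y₁ (d₁ X) → Ends x₂ y₂ (d₂ X) → Endpoints X x₁ y₁ x₂ y₂
    as21 : Ends x₁ y₁ (d₂ X) → Ends x₂ y₂ (d₁ X) → Endpoints X x₁ y₁ x₂ y₂

  record Realizes (X : Dissection2 N) (u : Gaps) : Set where
    constructor realizes
    field
      x₁ y₁ x₂ y₂ : ℕ
      endpoints   : Endpoints X x₁ y₁ x₂ y₂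
      step-P      : dist x₁ y₁ ≡ P u
      step-S      : dist y₁ x₂ ≡ S u
      step-Q      : dist x₂ y₂ ≡ Q u
      step-T      : dist y₂ x₁ ≡ T u
      once-round  : P u + S u + Q u + T u ≡ N

  ends<N : ∀ {x y d} → Ends x y d → x < N × y < N
  ends<N {d = d} (fwd refl refl) = <-trans (a<b d) (b<n d) , b<n d
  ends<N {d = d} (bwd refl refl) = b<n d , <-trans (a<b d) (b<n d)

  ends-flip : ∀ {x y d} → Ends x y d → Ends y x d
  ends-flip (fwd x≡a y≡b) = bwd y≡b x≡a
  ends-flip (bwd x≡b y≡a) = fwd y≡a x≡b

  endpoints<N : ∀ {X x₁ y₁ x₂ y₂} → Endpoints X x₁ y₁ x₂ y₂ → x₁ < N × y₁ < N × x₂ < N × y₂ < N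
  endpoints<N (as12 e₁ e₂) = let (x₁<N , y₁<N) = ends<N e₁ ; (x₂<N , y₂<N) = ends<N e₂ in x₁<N , y₁<N , x₂<N , y₂<N
  endpoints<N (as21 e₁ e₂) = let (x₁<N , y₁<N) = ends<N e₁ ; (x₂<N , y₂<N) = ends<N e₂ in x₁<N , y₁<N , x₂<N , y₂<N

  module Points {X u} (R : Realizes X u) where
    private
      bounds = endpoints<N (Realizes.endpoints R)

    x₁<N : Realizes.x₁ R < N
    x₁<N = proj₁ bounds

    y₁<N : Realizes.y₁ R < N
    y₁<N = proj₁ (proj₂ bounds)

    x₂<N : Realizes.x₂ R < N
    x₂<N = proj₁ (proj₂ (proj₂ bounds))

    y₂<N : Realizes.y₂ R < N
    y₂<N = proj₂ (proj₂ (proj₂ bounds))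

  endpoints-swap : ∀ {X x₁ y₁ x₂ y₂} → Endpoints X x₁ y₁ x₂ y₂ → Endpoints X x₂ y₂ x₁ y₁
  endpoints-swap (as12 e₁ e₂) = as21 e₂ e₁
  endpoints-swap (as21 e₁ e₂) = as12 e₂ e₁

  endpoints-flip : ∀ {X x₁ y₁ x₂ y₂} → Endpoints X x₁ y₁ x₂ y₂ → Endpoints X y₁ x₁ y₂ x₂
  endpoints-flip (as12 e₁ e₂) = as12 (ends-flip e₁) (ends-flip e₂)
  endpoints-flip (as21 e₁ e₂) = as21 (ends-flip e₁) (ends-flip e₂)

  ends-image : ∀ f r {x y d e} → DiagImg {N} f r d e → Ends x y d → Ends (actV N f r x) (actV N f r y) e
  ends-image f r (inj₁ (ga≡a , gb≡b)) (fwd refl refl) = fwd ga≡a gb≡b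
  ends-image f r (inj₂ (ga≡b , gb≡a)) (fwd refl refl) = bwd ga≡b gb≡a
  ends-image f r (inj₁ (ga≡a , gb≡b)) (bwd refl refl) = bwd gb≡b ga≡a
  ends-image f r (inj₂ (ga≡b , gb≡a)) (bwd refl refl) = fwd gb≡a ga≡b

  endpoints-image : ∀ f r {X Y x₁ y₁ x₂ y₂} → DissImg {N} f r X Y → Endpoints X x₁ y₁ x₂ y₂ →
                    Endpoints Y (actV N f r x₁) (actV N f r y₁) (actV N f r x₂) (actV N f r y₂)
  endpoints-image f r (inj₁ (i₁ , i₂)) (as12 e₁ e₂) = as12 (ends-image f r i₁ e₁) (ends-image f r i₂ e₂)
  endpoints-image f r (inj₁ (i₁ , i₂)) (as21 e₁ e₂) = as21 (ends-image f r i₂ e₁) (ends-image f r i₁ e₂)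
  endpoints-image f r (inj₂ (i₁ , i₂)) (as12 e₁ e₂) = as21 (ends-image f r i₁ e₁) (ends-image f r i₂ e₂)
  endpoints-image f r (inj₂ (i₁ , i₂)) (as21 e₁ e₂) = as12 (ends-image f r i₂ e₁) (ends-image f r i₁ e₂)

  ends-map : ∀ f r {x y x' y' d e} → Ends x y d → Ends x' y' e →
             actV N f r x ≡ x' → actV N f r y ≡ y' → DiagImg {N} f r d e
  ends-map f r (fwd refl refl) (fwd refl refl) gx gy = inj₁ (gx , gy)
  ends-map f r (fwd refl refl) (bwd refl refl) gx gy = inj₂ (gx , gy)
  ends-map f r (bwd refl refl) (fwd refl refl) gx gy = inj₂ (gy , gx)
  ends-map f r (bwd refl refl) (bwd refl refl) gx gy = inj₁ (gy , gx)

  endpoints-map : ∀ f r {X Y x₁ y₁ x₂ y₂ x₁' y₁' x₂' y₂'} →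
                  Endpoints X x₁ y₁ x₂ y₂ → Endpoints Y x₁' y₁' x₂' y₂' →
                  actV N f r x₁ ≡ x₁' → actV N f r y₁ ≡ y₁' → actV N f r x₂ ≡ x₂' → actV N f r y₂ ≡ y₂' →
                  DissImg {N} f r X Y
  endpoints-map f r (as12 e₁ e₂) (as12 e₁' e₂') g₁ h₁ g₂ h₂ = inj₁ (ends-map f r e₁ e₁' g₁ h₁ ,
                                                                    ends-map f r e₂ e₂' g₂ h₂)
  endpoints-map f r (as12 e₁ e₂) (as21 e₁' e₂') g₁ h₁ g₂ h₂ = inj₂ (ends-map f r e₁ e₁' g₁ h₁ ,
                                                                    ends-map f r e₂ e₂' g₂ h₂)
  endpoints-map f r (as21 e₁ e₂) (as12 e₁' e₂') g₁ h₁ g₂ h₂ = inj₂ (ends-map f r e₂ e₂' g₂ h₂ ,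
                                                                    ends-map f r e₁ e₁' g₁ h₁)
  endpoints-map f r (as21 e₁ e₂) (as21 e₁' e₂') g₁ h₁ g₂ h₂ = inj₁ (ends-map f r e₂ e₂' g₂ h₂ ,
                                                                    ends-map f r e₁ e₁' g₁ h₁)

  realizes-σ : ∀ {X u} → Realizes X u → Realizes X (σ u)
  realizes-σ {u = u} (realizes x₁ y₁ x₂ y₂ E sP sS sQ sT once) =
    realizes x₂ y₂ x₁ y₁ (endpoints-swap E) sQ sT sP sS (trans (σ-perimeter (P u) (S u) (Q u) (T u)) once)

  realizes-rotation : ∀ r {X Y u} → DissImg {N} false r X Y → Realizes X u → Realizes Y u
  realizes-rotation r img R@(realizes x₁ y₁ x₂ y₂ E sP sS sQ sT once) =
    realizes _ _ _ _ (endpoints-image false r img E)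
      (trans (dist-rotate r x₁ y₁ (<⇒≤ x₁<N)) sP) (trans (dist-rotate r y₁ x₂ (<⇒≤ y₁<N)) sS)
      (trans (dist-rotate r x₂ y₂ (<⇒≤ x₂<N)) sQ) (trans (dist-rotate r y₂ x₁ (<⇒≤ y₂<N)) sT) once
    where open Points R

  realizes-reflection : ∀ r {X Y u} → DissImg {N} true r X Y → Realizes X u → Realizes Y (ρ u)
  realizes-reflection r {u = u} img R@(realizes x₁ y₁ x₂ y₂ E sP sS sQ sT once) =
    realizes _ _ _ _ (endpoints-flip (endpoints-image true r img E))
      (trans (dist-reflect r y₁ x₁ y₁<N (<⇒≤ x₁<N)) sP) (trans (dist-reflect r x₁ y₂ x₁<N (<⇒≤ y₂<N)) sT)
      (trans (dist-reflect r y₂ x₂ y₂<N (<⇒≤ x₂<N)) sQ) (trans (dist-reflect r x₂ y₁ x₂<N (<⇒≤ y₁<N)) sS)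
      (trans (ρ-perimeter (P u) (S u) (Q u) (T u)) once)
    where open Points R

  -- A diagonal spans at least two sides, in either direction: forwards by
  -- `nonadj`, backwards because it is not the side {0 , n-1}.
  ends-dist≥2 : ∀ {x y d} → Ends x y d → 2 ≤ dist x y
  ends-dist≥2 {d = d} (fwd refl refl) =
    subst (2 ≤_) (sym (dist-forward (m+[n∸m]≡n (<⇒≤ (a<b d))) (b<n d))) (nonadj d)
  ends-dist≥2 {d = d} (bwd refl refl) with m≤n⇒∃[o]m+o≡n (b<n d)
  ... | o , 1+b+o≡N = subst (2 ≤_) (sym (dist-wrap wraps k<N (<⇒≤ (b<n d)))) (two o (a d) notWrap')
    where
    k = suc o + a d
    wraps : b d + k ≡ a d + N
    wraps = trans (regroup (b d) o (a d)) (trans (cong (_+ a d) 1+b+o≡N) (+-comm N (a d)))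
      where
      regroup : ∀ b o a → b + (suc o + a) ≡ suc b + o + a
      regroup = solve-∀
    k<N : k < N
    k<N = subst (k <_) 1+b+o≡N (s≤s (subst (_< b d + o) (+-comm (a d) o) (+-monoˡ-< o (a<b d))))
    notWrap' : a d ≡ 0 → o ≡ 0 → ⊥
    notWrap' a≡0 o≡0 = notWrap d (a≡0 , trans (sym (+-identityʳ _)) (trans (cong (suc (b d) +_) (sym o≡0)) 1+b+o≡N))
    two : ∀ o a → (a ≡ 0 → o ≡ 0 → ⊥) → 2 ≤ suc o + a
    two zero    zero    ¬both = ⊥-elim (¬both refl refl)
    two zero    (suc a) _     = s≤s (s≤s z≤n)
    two (suc o) a       _     = s≤s (s≤s z≤n)

  same-diagonal : ∀ {x y d e} → Ends x y d → Ends y x e → a d ≡ a e × b d ≡ b e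
  same-diagonal {d = d} {e} (fwd refl refl) (fwd a≡b b≡a) = ⊥-elim (<-asym (a<b d) (subst₂ _<_ (sym a≡b) (sym b≡a) (a<b e)))
  same-diagonal             (fwd refl refl) (bwd b≡b a≡a) = a≡a , b≡b
  same-diagonal             (bwd refl refl) (fwd b≡a a≡b) = b≡a , a≡b
  same-diagonal {d = d} {e} (bwd refl refl) (bwd b≡b a≡a) = ⊥-elim (<-asym (a<b d) (subst₂ _<_ (sym a≡a) (sym b≡b) (a<b e)))

  dist≡0⇒≡ : ∀ {x y} → x < N → y < N → dist x y ≡ 0 → x ≡ y
  dist≡0⇒≡ {x} x<N y<N d≡0 = sym (dist-injective (<⇒≤ x<N) y<N x<N (trans d≡0 (sym (dist-self x (<⇒≤ x<N)))))

  first-ends : ∀ {X x₁ y₁ x₂ y₂} → Endpoints X x₁ y₁ x₂ y₂ → Σ (Diagonal N) (Ends x₁ y₁)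
  first-ends (as12 e₁ _) = _ , e₁
  first-ends (as21 e₁ _) = _ , e₁

  second-ends : ∀ {X x₁ y₁ x₂ y₂} → Endpoints X x₁ y₁ x₂ y₂ → Σ (Diagonal N) (Ends x₂ y₂)
  second-ends (as12 _ e₂) = _ , e₂
  second-ends (as21 _ e₂) = _ , e₂

  -- The type of a 2-dissection is admissible; S + T ≥ 1 because S = T = 0
  -- would make the two diagonals equal.
  realizes-admissible : ∀ {X u} → Realizes X u → Admissible N u
  realizes-admissible {X} {u} R@(realizes x₁ y₁ x₂ y₂ E sP sS sQ sT once) =
    admissible (subst (2 ≤_) sP (ends-dist≥2 (proj₂ (first-ends E))))
               (subst (2 ≤_) sQ (ends-dist≥2 (proj₂ (second-ends E))))
               (nonzero-sum (S u) (T u) equal-diagonals) once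
    where
    open Points R
    equal-diagonals : S u ≡ 0 → T u ≡ 0 → ⊥
    equal-diagonals s≡0 t≡0 = distinct X (same E)
      where
      y₁≡x₂ : y₁ ≡ x₂
      y₁≡x₂ = dist≡0⇒≡ y₁<N x₂<N (trans sS s≡0)
      y₂≡x₁ : y₂ ≡ x₁
      y₂≡x₁ = dist≡0⇒≡ y₂<N x₁<N (trans sT t≡0)
      reversed : ∀ {d} → Ends x₂ y₂ d → Ends y₁ x₁ d
      reversed = subst₂ (λ z w → Ends z w _) (sym y₁≡x₂) y₂≡x₁
      same : Endpoints X x₁ y₁ x₂ y₂ → a (d₁ X) ≡ a (d₂ X) × b (d₁ X) ≡ b (d₂ X)
      same (as12 e₁ e₂) = same-diagonal e₁ (reversed e₂)
      same (as21 e₁ e₂) = let (a≡a , b≡b) = same-diagonal e₁ (reversed e₂) in sym a≡a , sym b≡b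

  ends-agree : ∀ {x y x' y' d} → Ends x y d → Ends x' y' d → (x' ≡ x × y' ≡ y) ⊎ (x' ≡ y × y' ≡ x)
  ends-agree (fwd refl refl) (fwd x'≡a y'≡b) = inj₁ (x'≡a , y'≡b)
  ends-agree (fwd refl refl) (bwd x'≡b y'≡a) = inj₂ (x'≡b , y'≡a)
  ends-agree (bwd refl refl) (fwd x'≡a y'≡b) = inj₂ (x'≡a , y'≡b)
  ends-agree (bwd refl refl) (bwd x'≡b y'≡a) = inj₁ (x'≡b , y'≡a)

  -- Distances along a realizing walk between points that are not consecutive,
  -- and the impossibility of reading the walk with a diagonal reversed: two
  -- consecutive steps of the re-read walk would already go round once.
  module Walk {X u} (R : Realizes X u) where
    open Realizes R
    open Points R

    private
      A = realizes-admissible R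
      x₁≤N = <⇒≤ x₁<N
      y₁≤N = <⇒≤ y₁<N
      x₂≤N = <⇒≤ x₂<N
      y₂≤N = <⇒≤ y₂<N
      add : ∀ x y z {k l} → x ≤ N → y ≤ N → dist x y ≡ k → dist y z ≡ l → k + l < N → dist x z ≡ k + l
      add x y z x≤N y≤N d₁ d₂ k+l<N =
        trans (dist-additive x y z x≤N y≤N (subst₂ (λ k l → k + l < N) (sym d₁) (sym d₂) k+l<N)) (cong₂ _+_ d₁ d₂)
      1≤Q = ≤-trans (s≤s z≤n) (2≤Q A)
      1≤P = ≤-trans (s≤s z≤n) (2≤P A)

    y₁→y₂ : dist y₁ y₂ ≡ S u + Q u
    y₁→y₂ = add y₁ x₂ y₂ y₁≤N x₂≤N step-S step-Q (S+Q<n A)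

    y₁→x₁ : dist y₁ x₁ ≡ S u + Q u + T u
    y₁→x₁ = add y₁ y₂ x₁ y₁≤N y₂≤N y₁→y₂ step-T (S+Q+T<n A)

    y₂→y₁ : dist y₂ y₁ ≡ T u + P u
    y₂→y₁ = add y₂ x₁ y₁ y₂≤N x₁≤N step-T step-P (T+P<n A)

    y₂→x₂ : dist y₂ x₂ ≡ T u + P u + S u
    y₂→x₂ = add y₂ y₁ x₂ y₂≤N y₁≤N y₂→y₁ step-S (T+P+S<n A)

    reversed-first : ∀ {w} → Admissible N w → dist y₁ x₁ ≡ P w → dist x₁ x₂ ≡ S w → ⊥
    reversed-first A' sP sS = <⇒≱ (P+S<n A') (subst (N ≤_) (cong₂ _+_ sP sS) (detour y₁ x₁ x₂ y₁≤N x₁≤N passes))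
      where
      passes : dist y₁ x₂ < dist y₁ x₁
      passes = subst₂ _<_ (sym step-S) (sym y₁→x₁) (≤-trans (m<m+n (S u) 1≤Q) (m≤m+n (S u + Q u) (T u)))

    reversed-second : ∀ {w} → Admissible N w → dist y₁ y₂ ≡ S w → dist y₂ x₂ ≡ Q w → ⊥
    reversed-second A' sS sQ = <⇒≱ (S+Q<n A') (subst (N ≤_) (cong₂ _+_ sS sQ) (detour y₁ y₂ x₂ y₁≤N y₂≤N passes))
      where
      passes : dist y₁ x₂ < dist y₁ y₂
      passes = subst₂ _<_ (sym step-S) (sym y₁→y₂) (m<m+n (S u) 1≤Q)

    -- With both diagonals reversed, the walk passes its target at the
    -- second step if T ≥ 1, and at the fourth step otherwise (then S ≥ 1).
    reversed-both : ∀ {w} → Admissible N w → dist y₁ x₁ ≡ P w → dist x₁ y₂ ≡ S w →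
                    dist y₂ x₂ ≡ Q w → dist x₂ y₁ ≡ T w → ⊥
    reversed-both A' sP sS sQ sT with T u ≟ 0
    ... | no t≢0 = <⇒≱ (P+S<n A') (subst (N ≤_) (cong₂ _+_ sP sS) (detour y₁ x₁ y₂ y₁≤N x₁≤N passes))
      where
      passes : dist y₁ y₂ < dist y₁ x₁
      passes = subst₂ _<_ (sym y₁→y₂) (sym y₁→x₁) (m<m+n (S u + Q u) (n≢0⇒n>0 t≢0))
    ... | yes t≡0 = <⇒≱ (Q+T<n A') (subst (N ≤_) (cong₂ _+_ sQ sT) (detour y₂ x₂ y₁ y₂≤N x₂≤N passes))
      where
      1≤S : 1 ≤ S u
      1≤S = subst (1 ≤_) (trans (cong (S u +_) t≡0) (+-identityʳ (S u))) (1≤S+T A)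
      passes : dist y₂ y₁ < dist y₂ x₂
      passes = subst₂ _<_ (sym y₂→y₁) (sym y₂→x₂) (m<m+n (T u + P u) 1≤S)

  aligned : ∀ {X u w d d'} (R : Realizes X u) (R' : Realizes X w) →
            Ends (Realizes.x₁ R) (Realizes.y₁ R) d → Ends (Realizes.x₂ R) (Realizes.y₂ R) d' →
            Ends (Realizes.x₁ R') (Realizes.y₁ R') d → Ends (Realizes.x₂ R') (Realizes.y₂ R') d' → w ≡ u
  aligned R@(realizes _ _ _ _ _ sP sS sQ sT _) R'@(realizes _ _ _ _ _ sP' sS' sQ' sT' _) e₁ e₂ f₁ f₂
    with ends-agree e₁ f₁ | ends-agree e₂ f₂
  ... | inj₁ (refl , refl) | inj₁ (refl , refl) =
    gaps-≡ (trans (sym sP') sP) (trans (sym sS') sS) (trans (sym sQ') sQ) (trans (sym sT') sT)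
  ... | inj₂ (refl , refl) | inj₁ (refl , refl) = ⊥-elim (Walk.reversed-first R (realizes-admissible R') sP' sS')
  ... | inj₁ (refl , refl) | inj₂ (refl , refl) = ⊥-elim (Walk.reversed-second R (realizes-admissible R') sS' sQ')
  ... | inj₂ (refl , refl) | inj₂ (refl , refl) = ⊥-elim (Walk.reversed-both R (realizes-admissible R') sP' sS' sQ' sT')

  realizes-unique : ∀ {X u w} → Realizes X u → Realizes X w → w ≡ u ⊎ w ≡ σ u
  realizes-unique R R'@(realizes _ _ _ _ E' _ _ _ _ _) with Realizes.endpoints R | E'
  ... | as12 e₁ e₂ | as12 f₁ f₂ = inj₁ (aligned R R' e₁ e₂ f₁ f₂)
  ... | as21 e₁ e₂ | as21 f₁ f₂ = inj₁ (aligned R R' e₁ e₂ f₁ f₂)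
  ... | as12 e₁ e₂ | as21 f₁ f₂ = inj₂ (cong σ (aligned R (realizes-σ R') e₁ e₂ f₂ f₁))
  ... | as21 e₁ e₂ | as12 f₁ f₂ = inj₂ (cong σ (aligned R (realizes-σ R') e₁ e₂ f₂ f₁))

  -- Dissections realizing the same type are rotations of each other: rotate
  -- the start x₁ of one walk onto the start x₁' of the other; equal steps then
  -- force the remaining points onto each other.
  rotate-between : ∀ {X Y u} → Realizes X u → Realizes Y u → SameOrbitZ X Y
  rotate-between R@(realizes x₁ y₁ x₂ y₂ E sP sS sQ sT _) R'@(realizes x₁' y₁' x₂' y₂' E' sP' sS' sQ' sT' _) =
    r , dist<N x₁ x₁' , endpoints-map false r E E' gx₁ gy₁ gx₂ gy₂
    where
    r = dist x₁ x₁'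
    g = actV N false r
    open Points R
    open Points R' renaming (x₁<N to x₁'<N; y₁<N to y₁'<N; x₂<N to x₂'<N; y₂<N to y₂'<N)
    next : ∀ v w {v' w'} → g v ≡ v' → v < N → v' < N → w' < N → dist v w ≡ dist v' w' → g w ≡ w'
    next v w {v'} {w'} gv v<N v'<N w'<N d = dist-injective (<⇒≤ v'<N) (m%n<n (w + r) N) w'<N (begin
      dist v' (g w)    ≡⟨ cong (λ z → dist z (g w)) gv ⟨
      dist (g v) (g w) ≡⟨ dist-rotate r v w (<⇒≤ v<N) ⟩
      dist v w         ≡⟨ d ⟩
      dist v' w'       ∎)
    gx₁ : g x₁ ≡ x₁'
    gx₁ = trans (dist-reaches x₁ x₁' (<⇒≤ x₁<N)) (m<n⇒m%n≡m x₁'<N)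
    gy₁ : g y₁ ≡ y₁'
    gy₁ = next x₁ y₁ gx₁ x₁<N x₁'<N y₁'<N (trans sP (sym sP'))
    gx₂ : g x₂ ≡ x₂'
    gx₂ = next y₁ x₂ gy₁ y₁<N y₁'<N x₂'<N (trans sS (sym sS'))
    gy₂ : g y₂ ≡ y₂'
    gy₂ = next x₂ y₂ gx₂ x₂<N x₂'<N y₂'<N (trans sQ (sym sQ'))

  -- If X realizes ρ u and Y realizes u, a reflection maps X onto Y: it sends
  -- y₁ to x₁' and reverses the walk of X into that of Y.
  reflect-between : ∀ {X Y u} → Realizes X (ρ u) → Realizes Y u → SameOrbitD X Y
  reflect-between R@(realizes x₁ y₁ x₂ y₂ E sP sT sQ sS _) R'@(realizes x₁' y₁' x₂' y₂' E' sP' sS' sQ' sT' _) =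
    true , r , m%n<n (y₁ + x₁') N , endpoints-map true r (endpoints-flip E) E' gy₁ gx₁ gy₂ gx₂
    where
    r = (y₁ + x₁') % N
    g = actV N true r
    open Points R
    open Points R' renaming (x₁<N to x₁'<N; y₁<N to y₁'<N; x₂<N to x₂'<N; y₂<N to y₂'<N)
    next : ∀ v w {v' w'} → g v ≡ v' → v < N → w < N → v' < N → w' < N → dist w v ≡ dist v' w' → g w ≡ w'
    next v w {v'} {w'} gv v<N w<N v'<N w'<N d = dist-injective (<⇒≤ v'<N) (m%n<n (r + (N ∸ w)) N) w'<N (begin
      dist v' (g w)    ≡⟨ cong (λ z → dist z (g w)) gv ⟨
      dist (g v) (g w) ≡⟨ dist-reflect r v w v<N (<⇒≤ w<N) ⟩
      dist w v         ≡⟨ d ⟩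
      dist v' w'       ∎)
    gy₁ : g y₁ ≡ x₁'
    gy₁ = dist-unique y₁ r x₁' x₁'<N (<⇒≤ y₁<N) (sym (m%n%n≡m%n (y₁ + x₁') N))
    gx₁ : g x₁ ≡ y₁'
    gx₁ = next y₁ x₁ gy₁ y₁<N x₁<N x₁'<N y₁'<N (trans sP (sym sP'))
    gy₂ : g y₂ ≡ x₂'
    gy₂ = next x₁ y₂ gx₁ x₁<N y₂<N y₁'<N x₂'<N (trans sS (sym sS'))
    gx₂ : g x₂ ≡ y₂'
    gx₂ = next y₂ x₂ gy₂ y₂<N x₂<N x₂'<N y₂'<N (trans sQ (sym sQ'))

  walk-around : ∀ {c₀ c₁ c₂ c₃ g₁ g₂ g₃ g₄} →
                c₀ + g₁ ≡ c₁ → c₁ + g₂ ≡ c₂ → c₂ + g₃ ≡ c₃ → c₃ + g₄ ≡ c₀ + N → c₃ < N → 1 ≤ g₁ + g₂ + g₃ →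
                dist c₀ c₁ ≡ g₁ × dist c₁ c₂ ≡ g₂ × dist c₂ c₃ ≡ g₃ × dist c₃ c₀ ≡ g₄ × g₁ + g₂ + g₃ + g₄ ≡ N
  walk-around {c₀} {g₁ = g₁} {g₂} {g₃} {g₄} refl refl refl wraps c₃<N 1≤g₁+g₂+g₃ =
    dist-forward refl c₁<N , dist-forward refl c₂<N , dist-forward refl c₃<N ,
    dist-wrap wraps g₄<N (<⇒≤ c₃<N) , once
    where
    c₂<N = ≤-<-trans (m≤m+n (c₀ + g₁ + g₂) g₃) c₃<N
    c₁<N = ≤-<-trans (m≤m+n (c₀ + g₁) g₂) c₂<N
    regroup : ∀ c₀ g₁ g₂ g₃ g₄ → c₀ + (g₁ + g₂ + g₃ + g₄) ≡ c₀ + g₁ + g₂ + g₃ + g₄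
    regroup = solve-∀
    once : g₁ + g₂ + g₃ + g₄ ≡ N
    once = +-cancelˡ-≡ c₀ _ _ (trans (regroup c₀ g₁ g₂ g₃ g₄) wraps)
    g₄<N : g₄ < N
    g₄<N = part< 1≤g₁+g₂+g₃ (trans (+-comm g₄ _) once)

  walk-sorted : ∀ {c₀ c₁ c₂ c₃} → c₀ ≤ c₁ → c₁ ≤ c₂ → c₂ ≤ c₃ → c₃ < N → 1 ≤ (c₁ ∸ c₀) + (c₂ ∸ c₁) + (c₃ ∸ c₂) →
                dist c₀ c₁ ≡ c₁ ∸ c₀ × dist c₁ c₂ ≡ c₂ ∸ c₁ × dist c₂ c₃ ≡ c₃ ∸ c₂ × dist c₃ c₀ ≡ (N ∸ c₃) + c₀ ×
                (c₁ ∸ c₀) + (c₂ ∸ c₁) + (c₃ ∸ c₂) + ((N ∸ c₃) + c₀) ≡ N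
  walk-sorted {c₀} {c₃ = c₃} c₀≤c₁ c₁≤c₂ c₂≤c₃ c₃<N =
    walk-around (m+[n∸m]≡n c₀≤c₁) (m+[n∸m]≡n c₁≤c₂) (m+[n∸m]≡n c₂≤c₃) wraps c₃<N
    where
    wraps : c₃ + ((N ∸ c₃) + c₀) ≡ c₀ + N
    wraps = trans (sym (+-assoc c₃ (N ∸ c₃) c₀)) (trans (cong (_+ c₀) (m+[n∸m]≡n (<⇒≤ c₃<N))) (+-comm N c₀))

  sequential : ∀ {X x₁ y₁ x₂ y₂} → Endpoints X x₁ y₁ x₂ y₂ → x₁ < y₁ → y₁ ≤ x₂ → x₂ < y₂ → y₂ < N → Σ Gaps (Realizes X)
  sequential {x₁ = x₁} {y₁} {x₂} {y₂} E x₁<y₁ y₁≤x₂ x₂<y₂ y₂<N =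
    let (s₁ , s₂ , s₃ , s₄ , once) = walk-sorted (<⇒≤ x₁<y₁) y₁≤x₂ (<⇒≤ x₂<y₂) y₂<N nonempty in
    gaps _ _ _ _ , realizes x₁ y₁ x₂ y₂ E s₁ s₂ s₃ s₄ once
    where
    nonempty : 1 ≤ (y₁ ∸ x₁) + (x₂ ∸ y₁) + (y₂ ∸ x₂)
    nonempty = ≤-trans (m<n⇒0<n∸m x₁<y₁) (≤-trans (m≤m+n _ (x₂ ∸ y₁)) (m≤m+n _ (y₂ ∸ x₂)))

  -- One diagonal inside the other: the walk reads the outer one backwards.
  nested : ∀ {X x₁ y₁ x₂ y₂} → Endpoints X x₁ y₁ x₂ y₂ → y₁ ≤ x₂ → x₂ < y₂ → y₂ ≤ x₁ → x₁ < N → Σ Gaps (Realizes X)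
  nested {x₁ = x₁} {y₁} {x₂} {y₂} E y₁≤x₂ x₂<y₂ y₂≤x₁ x₁<N =
    let (s₁ , s₂ , s₃ , s₄ , once) = walk-sorted y₁≤x₂ (<⇒≤ x₂<y₂) y₂≤x₁ x₁<N nonempty in
    gaps _ _ _ _ , realizes x₁ y₁ x₂ y₂ E s₄ s₁ s₂ s₃ (trans (rotate (x₂ ∸ y₁) (y₂ ∸ x₂) (x₁ ∸ y₂) ((N ∸ x₁) + y₁)) once)
    where
    nonempty : 1 ≤ (x₂ ∸ y₁) + (y₂ ∸ x₂) + (x₁ ∸ y₂)
    nonempty = ≤-trans (m<n⇒0<n∸m x₂<y₂) (≤-trans (m≤n+m _ (x₂ ∸ y₁)) (m≤m+n _ (x₁ ∸ y₂)))
    rotate : ∀ g₁ g₂ g₃ g₄ → g₄ + g₁ + g₂ + g₃ ≡ g₁ + g₂ + g₃ + g₄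
    rotate = solve-∀

  -- Every 2-dissection realizes some type: two non-crossing diagonals either
  -- follow each other or are nested.
  realizes-some : ∀ X → Σ Gaps (Realizes X)
  realizes-some X@(diss d d' _ noCross) with b d ≤? a d' | b d' ≤? a d
  ... | yes d-first | _            = sequential (as12 (fwd refl refl) (fwd refl refl)) (a<b d) d-first (a<b d') (b<n d')
  ... | no _        | yes d'-first = sequential (as21 (fwd refl refl) (fwd refl refl)) (a<b d') d'-first (a<b d) (b<n d)
  ... | no d≰       | no d'≰       with <-cmp (a d) (a d')
  ...   | tri< a<a' _ _ with b d' ≤? b d
  ...     | yes b'≤b = nested (as12 (bwd refl refl) (fwd refl refl)) (<⇒≤ a<a') (a<b d') b'≤b (b<n d)
  ...     | no  b'≰b = ⊥-elim (noCross (inj₁ (a<a' , ≰⇒> d≰ , ≰⇒> b'≰b)))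
  realizes-some X@(diss d d' _ noCross) | no _ | no _ | tri≈ _ a≡a' _ with b d' ≤? b d
  ...     | yes b'≤b = nested (as12 (bwd refl refl) (fwd refl refl)) (≤-reflexive a≡a') (a<b d') b'≤b (b<n d)
  ...     | no  b'≰b = nested (as21 (bwd refl refl) (fwd refl refl)) (≤-reflexive (sym a≡a')) (a<b d)
                                (<⇒≤ (≰⇒> b'≰b)) (b<n d')
  realizes-some X@(diss d d' _ noCross) | no _ | no d'≰ | tri> _ _ a'<a with b d ≤? b d'
  ...     | yes b≤b' = nested (as21 (bwd refl refl) (fwd refl refl)) (<⇒≤ a'<a) (a<b d) b≤b' (b<n d')
  ...     | no  b≰b' = ⊥-elim (noCross (inj₂ (a'<a , ≰⇒> d'≰ , ≰⇒> b≰b')))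

  -- The standard layout of an admissible type u with T u ≥ 1: the diagonals
  -- {0 , P} and {P + S , P + S + Q}.
  module Layout (u : Gaps) (A : Admissible N u) (1≤T : 1 ≤ T u) where
    private
      p = P u
      s = S u
      q = Q u
      D = p + s + q
      D<N : D < N
      D<N = part< 1≤T (perimeter A)
      2+p≤D : 2 + p ≤ D
      2+p≤D = subst (_≤ D) (+-comm p 2) (≤-trans (+-monoʳ-≤ p (2≤Q A)) (+-monoˡ-≤ q (m≤m+n p s)))
      1+p<N : suc p < N
      1+p<N = ≤-trans 2+p≤D (<⇒≤ D<N)
      p+s≢0 : p + s ≢ 0
      p+s≢0 p+s≡0 = <⇒≱ (s≤s z≤n) (subst (2 ≤_) (m+n≡0⇒m≡0 p p+s≡0) (2≤P A))
      first : Diagonal N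
      first = diag 0 p (≤-trans (s≤s z≤n) (2≤P A)) (<-trans (n<1+n p) 1+p<N) (2≤P A)
                   (λ (_ , 1+p≡N) → <⇒≢ 1+p<N 1+p≡N)
      second : Diagonal N
      second = diag (p + s) D (m<m+n (p + s) (≤-trans (s≤s z≤n) (2≤Q A))) D<N
                    (subst (2 ≤_) (sym (m+n∸m≡n (p + s) q)) (2≤Q A)) (λ (p+s≡0 , _) → p+s≢0 p+s≡0)
      uncrossed : ¬ Cross first second
      uncrossed (inj₁ (_ , p+s<p , _)) = m+n≮m p s p+s<p
      uncrossed (inj₂ (() , _))

    dissection : Dissection2 N
    dissection = diss first second (λ (0≡p+s , _) → p+s≢0 (sym 0≡p+s)) uncrossed

    realizes-layout : Realizes dissection u
    realizes-layout =
      let (s₁ , s₂ , s₃ , s₄ , once) = walk-around refl refl refl (perimeter A) D<N nonempty in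
      realizes 0 p (p + s) D (as12 (fwd refl refl) (fwd refl refl)) s₁ s₂ s₃ s₄ once
      where
      nonempty : 1 ≤ p + s + q
      nonempty = ≤-trans (s≤s z≤n) (≤-trans (2≤P A) (≤-trans (m≤m+n p s) (m≤m+n (p + s) q)))

  -- Every admissible type is realized: by its layout if T ≥ 1; otherwise S ≥ 1,
  -- and the layout of σ u, read from its second diagonal, realizes u.
  realizer : ∀ {u} → Admissible N u → Σ (Dissection2 N) (λ X → Realizes X u)
  realizer {u} A with 1 ≤? T u
  ... | yes 1≤T = Layout.dissection u A 1≤T , Layout.realizes-layout u A 1≤T
  ... | no  T≱1 = Layout.dissection (σ u) (admissible-σ A) 1≤S ,
                  realizes-σ (Layout.realizes-layout (σ u) (admissible-σ A) 1≤S)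
    where
    1≤S : 1 ≤ S u
    1≤S = subst (1 ≤_) (trans (cong (S u +_) (n<1⇒n≡0 (≰⇒> T≱1))) (+-identityʳ (S u))) (1≤S+T A)

  representative : ∀ {u} → Admissible N u → Dissection2 N
  representative A = proj₁ (realizer A)

  -- Orbits of Z_n correspond to σ-classes of types: the representatives of
  -- the canonical types lie in distinct orbits (their types are not
  -- σ-related), and every dissection is a rotation of the representative of
  -- the canonical form of its type.
  orbitsZ : NumOrbits (SameOrbitZ {N}) (length (canonicalZ N))
  orbitsZ = reps , length-mapAll (canonicalZ N) (sound E) rep , apart , cover
    where
    E = enum-canonicalZ N
    rep : ∀ u → Admissible N u × CanonZ u → Dissection2 N
    rep u (A , _) = representative A
    rep-realizes : ∀ u c → Realizes (rep u c) u
    rep-realizes u (A , _) = proj₂ (realizer A)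
    reps = mapAll (canonicalZ N) (sound E) rep
    distinct-orbits : ∀ x y → x ≢ y → ∀ cx cy → ¬ SameOrbitZ (rep x cx) (rep y cy)
    distinct-orbits x y x≢y cx cy (r , _ , img)
      with realizes-unique (rep-realizes y cy) (realizes-rotation r img (rep-realizes x cx))
    ... | inj₁ x≡y  = x≢y x≡y
    ... | inj₂ x≡σy = x≢y (trans x≡σy (canonZ-unique y (proj₂ cy) (subst CanonZ x≡σy (proj₂ cx))))
    apart : AllPairs (λ X Y → ¬ SameOrbitZ X Y) reps
    apart = mapAll-pairs (canonicalZ N) (sound E) rep (AllPairs.map (λ {x} {y} → distinct-orbits x y) (distinct E))
    rotated : ∀ {X} c → Realizes X c → Admissible N c × CanonZ c → Any (SameOrbitZ X) reps
    rotated c R cc = mapAll-any (canonicalZ N) (sound E) rep (complete E c cc)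
                       (λ c' → rotate-between R (rep-realizes c c'))
    cover : ∀ X → Any (SameOrbitZ X) reps
    cover X with realizes-some X
    ... | u , R with canonZ-total u
    ...   | inj₁ cu  = rotated u R (realizes-admissible R , cu)
    ...   | inj₂ cσu = rotated (σ u) (realizes-σ R) (admissible-σ (realizes-admissible R) , cσu)

  rotation-orbit : ∀ {X Y : Dissection2 N} → SameOrbitZ X Y → SameOrbitD X Y
  rotation-orbit (r , r<N , img) = false , r , r<N , img

  orbitsD : NumOrbits (SameOrbitD {N}) (length (canonicalD N))
  orbitsD = reps , length-mapAll (canonicalD N) (sound E) rep , apart , cover
    where
    E = enum-canonicalD N
    rep : ∀ u → Admissible N u × CanonD u → Dissection2 N
    rep u (A , _) = representative A
    rep-realizes : ∀ u c → Realizes (rep u c) u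
    rep-realizes u (A , _) = proj₂ (realizer A)
    reps = mapAll (canonicalD N) (sound E) rep
    distinct-orbits : ∀ x y → x ≢ y → ∀ cx cy → ¬ SameOrbitD (rep x cx) (rep y cy)
    distinct-orbits x y x≢y cx cy (false , r , _ , img) =
      x≢y (canonD-unique (proj₂ cx) (proj₂ cy)
             (inj₁ (realizes-unique (rep-realizes y cy) (realizes-rotation r img (rep-realizes x cx)))))
    distinct-orbits x y x≢y cx cy (true , r , _ , img) =
      x≢y (canonD-unique (proj₂ cx) (proj₂ cy)
             (inj₂ (realizes-unique (rep-realizes y cy) (realizes-reflection r img (rep-realizes x cx)))))
    apart : AllPairs (λ X Y → ¬ SameOrbitD X Y) reps
    apart = mapAll-pairs (canonicalD N) (sound E) rep (AllPairs.map (λ {x} {y} → distinct-orbits x y) (distinct E))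
    rotated : ∀ {X} c → Realizes X c → Admissible N c × CanonD c → Any (SameOrbitD X) reps
    rotated {X} c R cc = mapAll-any (canonicalD N) (sound E) rep (complete E c cc)
                           (λ c' → rotation-orbit {X} {rep c c'} (rotate-between R (rep-realizes c c')))
    reflected : ∀ {X} c → Realizes X (ρ c) → Admissible N c × CanonD c → Any (SameOrbitD X) reps
    reflected c R cc = mapAll-any (canonicalD N) (sound E) rep (complete E c cc)
                         (λ c' → reflect-between R (rep-realizes c c'))
    cover : ∀ X → Any (SameOrbitD X) reps
    cover X with realizes-some X
    ... | u , R with realizes-admissible R | canonD-total u
    ...   | A | inj₁ c               = rotated u R (A , c)
    ...   | A | inj₂ (inj₁ c)        = rotated (σ u) (realizes-σ R) (admissible-σ A , c)
    ...   | A | inj₂ (inj₂ (inj₁ c)) = reflected (ρ u) R (admissible-ρ A , c)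
    ...   | A | inj₂ (inj₂ (inj₂ c)) = reflected (σ (ρ u)) (realizes-σ R) (admissible-σ (admissible-ρ A) , c)

RotationEven RotationOdd DihedralEven DihedralOdd : ℕ → Set
RotationEven n = ∃[ m ] (12 * m ≡ n * (n ∸ 2) * (n ∸ 4) × NumOrbits (SameOrbitZ {n}) m)
RotationOdd  n = ∃[ m ] (12 * m ≡ (n + 1) * (n ∸ 3) * (n ∸ 4) × NumOrbits (SameOrbitZ {n}) m)
DihedralEven n = ∃[ m ] (24 * m ≡ (n ∸ 4) * (n ∸ 2) * (n + 3) × NumOrbits (SameOrbitD {n}) m)
DihedralOdd  n = ∃[ m ] (24 * m ≡ (n ∸ 3) * (n * n ∸ 13) × NumOrbits (SameOrbitD {n}) m)

even-shape : ∀ n → 2 ≤ n → n % 2 ≡ 0 → n ≡ 2 ⊎ ∃[ i ] n ≡ 4 + (i + i)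
even-shape n 2≤n n%2≡0 = shape (n / 2) (trans (m≡m%n+[m/n]*n n 2) (cong (_+ n / 2 * 2) n%2≡0))
  where
  double : ∀ i → suc (suc i) * 2 ≡ 4 + (i + i)
  double = solve-∀
  shape : ∀ j → n ≡ 0 + j * 2 → n ≡ 2 ⊎ ∃[ i ] n ≡ 4 + (i + i)
  shape zero          n≡0 = ⊥-elim (<⇒≱ (s≤s z≤n) (subst (2 ≤_) n≡0 2≤n))
  shape (suc zero)    n≡2 = inj₁ n≡2
  shape (suc (suc i)) n≡  = inj₂ (i , trans n≡ (double i))

odd-shape : ∀ n → 2 ≤ n → n % 2 ≡ 1 → n ≡ 3 ⊎ ∃[ i ] n ≡ 5 + (i + i)
odd-shape n 2≤n n%2≡1 = shape (n / 2) (trans (m≡m%n+[m/n]*n n 2) (cong (_+ n / 2 * 2) n%2≡1))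
  where
  double+1 : ∀ i → 1 + suc (suc i) * 2 ≡ 5 + (i + i)
  double+1 = solve-∀
  shape : ∀ j → n ≡ 1 + j * 2 → n ≡ 3 ⊎ ∃[ i ] n ≡ 5 + (i + i)
  shape zero          n≡1 = ⊥-elim (<⇒≱ (s≤s (s≤s z≤n)) (subst (2 ≤_) n≡1 2≤n))
  shape (suc zero)    n≡3 = inj₁ n≡3
  shape (suc (suc i)) n≡  = inj₂ (i , trans n≡ (double+1 i))

rotation-even : ∀ n → 2 ≤ n → n % 2 ≡ 0 → RotationEven n
rotation-even n 2≤n e with even-shape n 2≤n e
... | inj₁ refl       = 0 , refl , Polygon.orbitsZ 1
... | inj₂ (i , refl) = length (canonicalZ (4 + (i + i))) , count-Z-even i , Polygon.orbitsZ (3 + (i + i))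

rotation-odd : ∀ n → 2 ≤ n → n % 2 ≡ 1 → RotationOdd n
rotation-odd n 2≤n o with odd-shape n 2≤n o
... | inj₁ refl       = 0 , refl , Polygon.orbitsZ 2
... | inj₂ (i , refl) = length (canonicalZ (5 + (i + i))) , count-Z-odd i , Polygon.orbitsZ (4 + (i + i))

dihedral-even : ∀ n → 2 ≤ n → n % 2 ≡ 0 → DihedralEven n
dihedral-even n 2≤n e with even-shape n 2≤n e
... | inj₁ refl       = 0 , refl , Polygon.orbitsD 1
... | inj₂ (i , refl) = length (canonicalD (4 + (i + i))) , count-D-even i , Polygon.orbitsD (3 + (i + i))

dihedral-odd : ∀ n → 2 ≤ n → n % 2 ≡ 1 → DihedralOdd n
dihedral-odd n 2≤n o with odd-shape n 2≤n o
... | inj₁ refl       = 0 , refl , Polygon.orbitsD 2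
... | inj₂ (i , refl) = length (canonicalD (5 + (i + i))) , count-D-odd i , Polygon.orbitsD (4 + (i + i))

theorem5 : (n : ℕ) → 2 ≤ n →
    ((n % 2 ≡ 0 → ∃[ m ] (12 * m ≡ n * (n ∸ 2) * (n ∸ 4) × NumOrbits (SameOrbitZ {n}) m))
     × (n % 2 ≡ 1 → ∃[ m ] (12 * m ≡ (n + 1) * (n ∸ 3) * (n ∸ 4) × NumOrbits (SameOrbitZ {n}) m)))
    × ((n % 2 ≡ 0 → ∃[ m ] (24 * m ≡ (n ∸ 4) * (n ∸ 2) * (n + 3) × NumOrbits (SameOrbitD {n}) m))
     × (n % 2 ≡ 1 → ∃[ m ] (24 * m ≡ (n ∸ 3) * (n * n ∸ 13) × NumOrbits (SameOrbitD {n}) m)))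
theorem5 n 2≤n = (rotation-even n 2≤n , rotation-odd n 2≤n) , (dihedral-even n 2≤n , dihedral-odd n 2≤n)
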